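{- For every set $X$, if $G$ is sufficiently Cohen generic relative to $X$ (i.e. $G$ lies in a suitable comeager subset of Cantor space determined by $X$), then $G$ preserves the arithmetic hierarchy relative to $X$.
   Context: For $n>0$, a set is properly $\Sigma^0_n$ (resp. $\Pi^0_n$) relative to $X$ if it is $\Sigma^0_n$ but not $\Pi^0_n$ (resp. $\Pi^0_n$ but not $\Sigma^0_n$) relative to $X$; properly $\Delta^0_{n+1}$ relative to $X$ if it is $\Delta^0_{n+1}$ but neither $\Sigma^0_n$ nor $\Pi^0_n$ relative to $X$. $G$ preserves the arithmetic hierarchy relative to $X$ if for every $n>0$ and every $\Xi\in\{\Sigma^0_n,\Pi^0_n,\Delta^0_{n+1}\}$, every set that is properly $\Xi$ relative to $X$ is properly $\Xi$ relative to $X\oplus G$. -}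

module Defs where

open import Data.Nat using (ℕ; zero; suc; _+_; _*_; _<_; _>_)
open import Data.Nat.DivMod using (_/_; _%_)
open import Data.Bool using (Bool; true; false)
open import Data.Product using (Σ; _×_)
open import Data.Sum using (_⊎_)
open import Relation.Nullary using (¬_)
open import Relation.Binary.PropositionalEquality using (_≡_)
open import Function.Bundles using (_⇔_)

Cantor : Set
Cantor = ℕ → Bool

_∈ˢ_ : ℕ → Cantor → Set
x ∈ˢ A = A x ≡ true

_⊕_ : Cantor → Cantor → Cantor
(X ⊕ G) m with m % 2
... | zero = X (m / 2)
... | suc _ = G (m / 2)

Env : Set
Env = ℕ → ℕ

_∷ᵉ_ : ℕ → Env → Env
(y ∷ᵉ ρ) zero = y
(y ∷ᵉ ρ) (suc i) = ρ i

data Term : Set where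
  var  : ℕ → Term
  zro  : Term
  sucᵗ : Term → Term
  _+ᵗ_ : Term → Term → Term
  _*ᵗ_ : Term → Term → Term

evalᵗ : Env → Term → ℕ
evalᵗ ρ (var i) = ρ i
evalᵗ ρ zro = zero
evalᵗ ρ (sucᵗ t) = suc (evalᵗ ρ t)
evalᵗ ρ (s +ᵗ t) = evalᵗ ρ s + evalᵗ ρ t
evalᵗ ρ (s *ᵗ t) = evalᵗ ρ s * evalᵗ ρ t

data Δ₀ : Set where
  _≐_  : Term → Term → Δ₀
  _<ᶠ_ : Term → Term → Δ₀
  mem  : Term → Δ₀
  ¬ᶠ_  : Δ₀ → Δ₀
  _∧ᶠ_ : Δ₀ → Δ₀ → Δ₀
  _∨ᶠ_ : Δ₀ → Δ₀ → Δ₀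
  ∀<   : Term → Δ₀ → Δ₀       -- ∀ y < t . φ   (y is variable 0 in φ)
  ∃<   : Term → Δ₀ → Δ₀

⟦_⟧ : Δ₀ → Cantor → Env → Set
⟦ s ≐ t ⟧ Y ρ = evalᵗ ρ s ≡ evalᵗ ρ t
⟦ s <ᶠ t ⟧ Y ρ = evalᵗ ρ s < evalᵗ ρ t
⟦ mem t ⟧ Y ρ = evalᵗ ρ t ∈ˢ Y
⟦ ¬ᶠ φ ⟧ Y ρ = ¬ ⟦ φ ⟧ Y ρ
⟦ φ ∧ᶠ ψ ⟧ Y ρ = ⟦ φ ⟧ Y ρ × ⟦ ψ ⟧ Y ρ
⟦ φ ∨ᶠ ψ ⟧ Y ρ = ⟦ φ ⟧ Y ρ ⊎ ⟦ ψ ⟧ Y ρ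
⟦ ∀< t φ ⟧ Y ρ = (y : ℕ) → y < evalᵗ ρ t → ⟦ φ ⟧ Y (y ∷ᵉ ρ)
⟦ ∃< t φ ⟧ Y ρ = Σ ℕ λ y → y < evalᵗ ρ t × ⟦ φ ⟧ Y (y ∷ᵉ ρ)

-- n alternating unbounded quantifiers in front of a Δ₀ matrix;
-- 'true' = starting with ∃ (Σ-form), 'false' = starting with ∀ (Π-form).
QSat : ℕ → Bool → Δ₀ → Cantor → Env → Set
QSat zero _ θ Y ρ = ⟦ θ ⟧ Y ρ
QSat (suc n) true θ Y ρ = Σ ℕ λ y → QSat n false θ Y (y ∷ᵉ ρ)
QSat (suc n) false θ Y ρ = (y : ℕ) → QSat n true θ Y (y ∷ᵉ ρ)

-- The free variable x is variable number n (outermost); any other free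
-- variables are interpreted as 0.
initEnv : ℕ → Env
initEnv x = x ∷ᵉ (λ _ → zero)

Σ⁰ : ℕ → Cantor → Cantor → Set
Σ⁰ n Y A = Σ Δ₀ λ θ → (x : ℕ) → (x ∈ˢ A ⇔ QSat n true θ Y (initEnv x))

Π⁰ : ℕ → Cantor → Cantor → Set
Π⁰ n Y A = Σ Δ₀ λ θ → (x : ℕ) → (x ∈ˢ A ⇔ QSat n false θ Y (initEnv x))

Δ⁰ : ℕ → Cantor → Cantor → Set
Δ⁰ n Y A = Σ⁰ n Y A × Π⁰ n Y A

ProperΣ⁰ : ℕ → Cantor → Cantor → Set
ProperΣ⁰ n Y A = Σ⁰ n Y A × ¬ Π⁰ n Y A

ProperΠ⁰ : ℕ → Cantor → Cantor → Set
ProperΠ⁰ n Y A = Π⁰ n Y A × ¬ Σ⁰ n Y A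

ProperΔ⁰suc : ℕ → Cantor → Cantor → Set
ProperΔ⁰suc n Y A = Δ⁰ (suc n) Y A × ¬ Σ⁰ n Y A × ¬ Π⁰ n Y A

PreservesAH : Cantor → Cantor → Set
PreservesAH X G = (n : ℕ) → n > 0 → (A : Cantor) →
    (ProperΣ⁰ n X A → ProperΣ⁰ n (X ⊕ G) A)
  × (ProperΠ⁰ n X A → ProperΠ⁰ n (X ⊕ G) A)
  × (ProperΔ⁰suc n X A → ProperΔ⁰suc n (X ⊕ G) A)

AgreeBelow : ℕ → Cantor → Cantor → Set
AgreeBelow n G H = (i : ℕ) → i < n → G i ≡ H i

IsOpen : (Cantor → Set) → Set
IsOpen U = (G : Cantor) → U G → Σ ℕ λ n → (H : Cantor) → AgreeBelow n G H → U H

IsDense : (Cantor → Set) → Set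
IsDense U = (G : Cantor) (n : ℕ) → Σ Cantor λ H → AgreeBelow n G H × U H

IsComeager : (Cantor → Set) → Set₁
IsComeager C = Σ (ℕ → Cantor → Set) λ U →
  ((i : ℕ) → IsOpen (U i) × IsDense (U i)) × ((G : Cantor) → ((i : ℕ) → U i G) → C G)

module Submission where

-- Σ⁰ₙ(X) ⊆ Σ⁰ₙ(X ⊕ G) and Π⁰ₙ(X) ⊆ Π⁰ₙ(X ⊕ G) hold for every G (`embed`), so
-- the content is Σ-reflection: for generic G, an arithmetical set that is
-- Σ⁰ₘ₊₁ over X ⊕ G is Σ⁰ₘ₊₁ over X (Π-reflection follows by complements).
-- This is proved by forcing with finite bit strings.  `Forces` is forcing of
-- prenex formulas; `ForcesCoded` restricts it to conditions coded by numbers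
-- (Gödel's β-function) and is Π⁰ₖ-definable over X (`definability`, which
-- needs merging of like quantifiers via pairing and a translation of Δ₀
-- formulas over X ⊕ G into formulas over X).  Genericity means meeting two
-- countable families of dense sets: `Decides` yields the truth lemma, and
-- `Separates` provides an initial segment c₁ of G that forces the candidate
-- definition nowhere outside the set, which is then defined over X as
-- "some coded extension of c₁ forces it".  Enumerating the syntax shows that
-- the generic sets form a comeager set.

open import Level using (0ℓ)
open import Axiom.ExcludedMiddle using (ExcludedMiddle)
open import Data.Nat using (ℕ; zero; suc; _+_; _*_; _≤_; _<_; _>_; z≤n; s≤s; _⊔_; _∸_; _!)
open import Data.Nat.Properties
open import Data.Nat.Divisibility using (_∣_; divides; _∣?_; ∣-trans; ∣-refl; ∣m+n∣m⇒∣n; ∣n⇒∣m*n; m∣m*n; ∣1⇒≡1; m≤n⇒m!∣n!)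
open import Data.Nat.Coprimality using (Coprime; coprime-divisor)
import Data.Nat.Coprimality as Coprime
open import Data.Nat.DivMod using (_%_; _/_; m*n%n≡0; m*n/n≡m; [m+kn]%n≡m%n; +-distrib-/)
open import Data.Bool using (Bool; true; false; not; if_then_else_)
open import Data.Product using (Σ; _×_; _,_; proj₁; proj₂)
open import Data.Product.Function.NonDependent.Propositional using (_×-⇔_)
open import Data.Sum using (_⊎_; inj₁; inj₂)
open import Data.Sum.Function.Propositional using (_⊎-⇔_)
open import Data.Empty using (⊥; ⊥-elim)
open import Data.List using (List; []; _∷_; length; _++_; [_])
open import Data.List.Properties using (length-++)
open import Relation.Nullary using (¬_; Dec; yes; no; does)
open import Relation.Nullary.Decidable using (dec-true)
open import Relation.Binary.Definitions using (tri<; tri≈; tri>)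
open import Relation.Binary.PropositionalEquality hiding ([_])
open import Function using (id)
open import Function.Bundles using (_⇔_; mk⇔; Equivalence)
open import Function.Properties.Equivalence using (⇔-setoid)
import Function.Properties.Equivalence as ⇔
open import Function.Related.TypeIsomorphisms using (¬-cong-⇔; →-cong-⇔)
open import Defs

open Equivalence using (to; from)

∀-⇔ : {A B : ℕ → Set} → (∀ y → A y ⇔ B y) → ((y : ℕ) → A y) ⇔ ((y : ℕ) → B y)
∀-⇔ e = mk⇔ (λ f y → to (e y) (f y)) (λ f y → from (e y) (f y))

∃-⇔ : {A B : ℕ → Set} → (∀ y → A y ⇔ B y) → Σ ℕ A ⇔ Σ ℕ B
∃-⇔ e = mk⇔ (λ (y , a) → y , to (e y) a) (λ (y , b) → y , from (e y) b)

∀<-⇔ : {A B : ℕ → Set} {t t' : ℕ} → t ≡ t' → (∀ y → y < t → A y ⇔ B y) →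
       ((y : ℕ) → y < t → A y) ⇔ ((y : ℕ) → y < t' → B y)
∀<-⇔ refl e = mk⇔ (λ f y p → to (e y p) (f y p)) (λ f y p → from (e y p) (f y p))

∃<-⇔ : {A B : ℕ → Set} {t t' : ℕ} → t ≡ t' → (∀ y → y < t → A y ⇔ B y) →
       (Σ ℕ λ y → y < t × A y) ⇔ (Σ ℕ λ y → y < t' × B y)
∃<-⇔ refl e = mk⇔ (λ (y , p , a) → y , p , to (e y p) a) (λ (y , p , b) → y , p , from (e y p) b)

≡⇒⇔ : {A B : Set} → A ≡ B → A ⇔ B
≡⇒⇔ refl = ⇔.refl

liftRen : (ℕ → ℕ) → ℕ → ℕ
liftRen f zero = zero
liftRen f (suc i) = suc (f i)

renameᵗ : (ℕ → ℕ) → Term → Term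
renameᵗ f (var i) = var (f i)
renameᵗ f zro = zro
renameᵗ f (sucᵗ t) = sucᵗ (renameᵗ f t)
renameᵗ f (s +ᵗ t) = renameᵗ f s +ᵗ renameᵗ f t
renameᵗ f (s *ᵗ t) = renameᵗ f s *ᵗ renameᵗ f t

rename : (ℕ → ℕ) → Δ₀ → Δ₀
rename f (s ≐ t) = renameᵗ f s ≐ renameᵗ f t
rename f (s <ᶠ t) = renameᵗ f s <ᶠ renameᵗ f t
rename f (mem t) = mem (renameᵗ f t)
rename f (¬ᶠ φ) = ¬ᶠ rename f φ
rename f (φ ∧ᶠ ψ) = rename f φ ∧ᶠ rename f ψ
rename f (φ ∨ᶠ ψ) = rename f φ ∨ᶠ rename f ψ
rename f (∀< t φ) = ∀< (renameᵗ f t) (rename (liftRen f) φ)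
rename f (∃< t φ) = ∃< (renameᵗ f t) (rename (liftRen f) φ)

Renames : (ℕ → ℕ) → Env → Env → Set
Renames f ρ ρ' = ∀ i → ρ (f i) ≡ ρ' i

Renames-lift : ∀ {f ρ ρ'} y → Renames f ρ ρ' → Renames (liftRen f) (y ∷ᵉ ρ) (y ∷ᵉ ρ')
Renames-lift y r zero = refl
Renames-lift y r (suc i) = r i

evalᵗ-rename : ∀ {f ρ ρ'} → Renames f ρ ρ' → ∀ t → evalᵗ ρ (renameᵗ f t) ≡ evalᵗ ρ' t
evalᵗ-rename r (var i) = r i
evalᵗ-rename r zro = refl
evalᵗ-rename r (sucᵗ t) = cong suc (evalᵗ-rename r t)
evalᵗ-rename r (s +ᵗ t) = cong₂ _+_ (evalᵗ-rename r s) (evalᵗ-rename r t)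
evalᵗ-rename r (s *ᵗ t) = cong₂ _*_ (evalᵗ-rename r s) (evalᵗ-rename r t)

⟦rename⟧ : ∀ Y f θ {ρ ρ'} → Renames f ρ ρ' → ⟦ rename f θ ⟧ Y ρ ⇔ ⟦ θ ⟧ Y ρ'
⟦rename⟧ Y f (s ≐ t) r = ≡⇒⇔ (cong₂ _≡_ (evalᵗ-rename r s) (evalᵗ-rename r t))
⟦rename⟧ Y f (s <ᶠ t) r = ≡⇒⇔ (cong₂ _<_ (evalᵗ-rename r s) (evalᵗ-rename r t))
⟦rename⟧ Y f (mem t) r = ≡⇒⇔ (cong (_∈ˢ Y) (evalᵗ-rename r t))
⟦rename⟧ Y f (¬ᶠ θ) r = ¬-cong-⇔ (⟦rename⟧ Y f θ r)
⟦rename⟧ Y f (θ ∧ᶠ φ) r = ⟦rename⟧ Y f θ r ×-⇔ ⟦rename⟧ Y f φ r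
⟦rename⟧ Y f (θ ∨ᶠ φ) r = ⟦rename⟧ Y f θ r ⊎-⇔ ⟦rename⟧ Y f φ r
⟦rename⟧ Y f (∀< t θ) r =
  ∀<-⇔ (evalᵗ-rename r t) (λ y _ → ⟦rename⟧ Y (liftRen f) θ (Renames-lift y r))
⟦rename⟧ Y f (∃< t θ) r =
  ∃<-⇔ (evalᵗ-rename r t) (λ y _ → ⟦rename⟧ Y (liftRen f) θ (Renames-lift y r))

Modulus : Cantor → Env → Δ₀ → ℕ → Set
Modulus Y ρ θ N = ∀ Y' → AgreeBelow N Y Y' → ⟦ θ ⟧ Y ρ ⇔ ⟦ θ ⟧ Y' ρ

AgreeBelow-mono : ∀ {N N' Y Y'} → N ≤ N' → AgreeBelow N' Y Y' → AgreeBelow N Y Y'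
AgreeBelow-mono N≤N' a i i<N = a i (≤-trans i<N N≤N')

Modulus-mono : ∀ {Y ρ θ N N'} → N ≤ N' → Modulus Y ρ θ N → Modulus Y ρ θ N'
Modulus-mono N≤N' m Y' a = m Y' (AgreeBelow-mono N≤N' a)

common-bound : (Q : ℕ → ℕ → Set) → (∀ {y N N'} → N ≤ N' → Q y N → Q y N') →
  (∀ y → Σ ℕ (Q y)) → ∀ b → Σ ℕ λ N → ∀ y → y < b → Q y N
common-bound Q mono q zero = 0 , λ y ()
common-bound Q mono q (suc b) with common-bound Q mono q b | q b
... | N , below | M , at = N ⊔ M , λ y y<1+b → cases y (m<1+n⇒m<n∨m≡n y<1+b)
  where
  cases : ∀ y → y < b ⊎ y ≡ b → Q y (N ⊔ M)
  cases y (inj₁ y<b) = mono (m≤m⊔n N M) (below y y<b)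
  cases y (inj₂ refl) = mono (m≤n⊔m N M) at

continuity : ∀ Y θ ρ → Σ ℕ (Modulus Y ρ θ)
continuity Y (s ≐ t) ρ = 0 , λ _ _ → ⇔.refl
continuity Y (s <ᶠ t) ρ = 0 , λ _ _ → ⇔.refl
continuity Y (mem t) ρ = suc (evalᵗ ρ t) , λ Y' a → ≡⇒⇔ (cong (_≡ true) (a (evalᵗ ρ t) ≤-refl))
continuity Y (¬ᶠ θ) ρ with continuity Y θ ρ
... | N , m = N , λ Y' a → ¬-cong-⇔ (m Y' a)
continuity Y (θ ∧ᶠ φ) ρ with continuity Y θ ρ | continuity Y φ ρ
... | N , m | M , m' = N ⊔ M , λ Y' a →
  Modulus-mono (m≤m⊔n N M) m Y' a ×-⇔ Modulus-mono (m≤n⊔m N M) m' Y' a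
continuity Y (θ ∨ᶠ φ) ρ with continuity Y θ ρ | continuity Y φ ρ
... | N , m | M , m' = N ⊔ M , λ Y' a →
  Modulus-mono (m≤m⊔n N M) m Y' a ⊎-⇔ Modulus-mono (m≤n⊔m N M) m' Y' a
continuity Y (∀< t θ) ρ
  with common-bound (λ y → Modulus Y (y ∷ᵉ ρ) θ) Modulus-mono (λ y → continuity Y θ (y ∷ᵉ ρ)) (evalᵗ ρ t)
... | N , m = N , λ Y' a → ∀<-⇔ refl (λ y y<t → m y y<t Y' a)
continuity Y (∃< t θ) ρ
  with common-bound (λ y → Modulus Y (y ∷ᵉ ρ) θ) Modulus-mono (λ y → continuity Y θ (y ∷ᵉ ρ)) (evalᵗ ρ t)
... | N , m = N , λ Y' a → ∃<-⇔ refl (λ y y<t → m y y<t Y' a)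

-- `ys ++ᵉ ρ` extends ρ by the values ys, the head of ys becoming variable 0.
-- The matrix of a prenex formula with m quantifiers is evaluated in such
-- environments with `length ys ≡ m`.
_++ᵉ_ : List ℕ → Env → Env
[] ++ᵉ ρ = ρ
(y ∷ ys) ++ᵉ ρ = y ∷ᵉ (ys ++ᵉ ρ)

++ᵉ-snoc : ∀ ys y ρ → ((ys ++ [ y ]) ++ᵉ ρ) ≡ (ys ++ᵉ (y ∷ᵉ ρ))
++ᵉ-snoc [] y ρ = refl
++ᵉ-snoc (z ∷ ys) y ρ = cong (z ∷ᵉ_) (++ᵉ-snoc ys y ρ)

++ᵉ-beyond : ∀ ys ρ i → (ys ++ᵉ ρ) (length ys + i) ≡ ρ i
++ᵉ-beyond [] ρ i = refl
++ᵉ-beyond (y ∷ ys) ρ i = ++ᵉ-beyond ys ρ i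

++ᵉ-at : ∀ ys w ρ → (ys ++ᵉ (w ∷ᵉ ρ)) (length ys) ≡ w
++ᵉ-at [] w ρ = refl
++ᵉ-at (y ∷ ys) w ρ = ++ᵉ-at ys w ρ

prefix-step : ∀ {m} (R : Env → Env → Set) ρ₁ ρ₂ y →
  (∀ ys → length ys ≡ suc m → R (ys ++ᵉ ρ₁) (ys ++ᵉ ρ₂)) →
  ∀ ys → length ys ≡ m → R (ys ++ᵉ (y ∷ᵉ ρ₁)) (ys ++ᵉ (y ∷ᵉ ρ₂))
prefix-step R ρ₁ ρ₂ y h ys len = subst₂ R (++ᵉ-snoc ys y ρ₁) (++ᵉ-snoc ys y ρ₂)
  (h (ys ++ [ y ]) (trans (length-++ ys) (trans (+-comm (length ys) 1) (cong suc len))))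

MatricesAgree : Δ₀ → Δ₀ → Cantor → Cantor → Env → Env → Set
MatricesAgree θ₁ θ₂ Y₁ Y₂ ρ₁ ρ₂ = ⟦ θ₁ ⟧ Y₁ ρ₁ ⇔ ⟦ θ₂ ⟧ Y₂ ρ₂

QSat-cong : ∀ m b θ₁ θ₂ Y₁ Y₂ ρ₁ ρ₂ →
  (∀ ys → length ys ≡ m → ⟦ θ₁ ⟧ Y₁ (ys ++ᵉ ρ₁) ⇔ ⟦ θ₂ ⟧ Y₂ (ys ++ᵉ ρ₂)) →
  QSat m b θ₁ Y₁ ρ₁ ⇔ QSat m b θ₂ Y₂ ρ₂
QSat-cong zero b θ₁ θ₂ Y₁ Y₂ ρ₁ ρ₂ h = h [] refl
QSat-cong (suc m) true θ₁ θ₂ Y₁ Y₂ ρ₁ ρ₂ h = ∃-⇔ λ y →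
  QSat-cong m false θ₁ θ₂ Y₁ Y₂ (y ∷ᵉ ρ₁) (y ∷ᵉ ρ₂) (prefix-step (MatricesAgree θ₁ θ₂ Y₁ Y₂) ρ₁ ρ₂ y h)
QSat-cong (suc m) false θ₁ θ₂ Y₁ Y₂ ρ₁ ρ₂ h = ∀-⇔ λ y →
  QSat-cong m true θ₁ θ₂ Y₁ Y₂ (y ∷ᵉ ρ₁) (y ∷ᵉ ρ₂) (prefix-step (MatricesAgree θ₁ θ₂ Y₁ Y₂) ρ₁ ρ₂ y h)

⊤ᶠ : Δ₀
⊤ᶠ = zro ≐ zro

⊥ᶠ : Δ₀
⊥ᶠ = ¬ᶠ ⊤ᶠ

infixr 4 _⇒ᶠ_
_⇒ᶠ_ : Δ₀ → Δ₀ → Δ₀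
A ⇒ᶠ B = (¬ᶠ A) ∨ᶠ B

QSat-⊤ : ∀ m b Y ρ → QSat m b ⊤ᶠ Y ρ
QSat-⊤ zero b Y ρ = refl
QSat-⊤ (suc m) true Y ρ = 0 , QSat-⊤ m false Y (0 ∷ᵉ ρ)
QSat-⊤ (suc m) false Y ρ = λ y → QSat-⊤ m true Y (y ∷ᵉ ρ)

QSat-⊥ : ∀ m b Y ρ → ¬ QSat m b ⊥ᶠ Y ρ
QSat-⊥ zero b Y ρ h = h refl
QSat-⊥ (suc m) true Y ρ (y , q) = QSat-⊥ m false Y (y ∷ᵉ ρ) q
QSat-⊥ (suc m) false Y ρ f = QSat-⊥ m true Y (0 ∷ᵉ ρ) (f 0)

QSat-valid : ∀ m b θ Y ρ → (∀ ys → length ys ≡ m → ⟦ θ ⟧ Y (ys ++ᵉ ρ)) → QSat m b θ Y ρ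
QSat-valid m b θ Y ρ h = from (QSat-cong m b θ ⊤ᶠ Y Y ρ ρ (λ ys len → mk⇔ (λ _ → refl) (λ _ → h ys len))) (QSat-⊤ m b Y ρ)

QSat-unsat : ∀ m b θ Y ρ → (∀ ys → length ys ≡ m → ¬ ⟦ θ ⟧ Y (ys ++ᵉ ρ)) → ¬ QSat m b θ Y ρ
QSat-unsat m b θ Y ρ h q = QSat-⊥ m b Y ρ (to (QSat-cong m b θ ⊥ᶠ Y Y ρ ρ
  (λ ys len → mk⇔ (λ t _ → h ys len t) (λ f → ⊥-elim (f refl)))) q)

weaken : ℕ → Δ₀ → Δ₀
weaken m A = rename (m +_) A

⟦weaken⟧ : ∀ Y A ys ρ m → length ys ≡ m → ⟦ weaken m A ⟧ Y (ys ++ᵉ ρ) ⇔ ⟦ A ⟧ Y ρ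
⟦weaken⟧ Y A ys ρ m refl = ⟦rename⟧ Y (length ys +_) A (++ᵉ-beyond ys ρ)

pair : ℕ → ℕ → ℕ
pair a b = (a + b) * (a + b) + a

pairᵗ : Term → Term → Term
pairᵗ a b = ((a +ᵗ b) *ᵗ (a +ᵗ b)) +ᵗ a

-- Pairs with a larger coordinate sum have larger codes, since s² + s < (s+1)².
pair-< : ∀ a b a' b' → a + b < a' + b' → pair a b < pair a' b'
pair-< a b a' b' lt = begin-strict
  s * s + a               ≤⟨ +-monoʳ-≤ (s * s) (m≤m+n a b) ⟩
  s * s + s               ≡⟨ +-comm (s * s) s ⟩
  s + s * s               ≤⟨ m≤n+m (s + s * s) s ⟩
  s + (s + s * s)         <⟨ n<1+n _ ⟩
  suc (s + (s + s * s))   ≡⟨ cong (λ z → suc (s + z)) (sym (*-suc s s)) ⟩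
  suc s * suc s           ≤⟨ *-mono-≤ lt lt ⟩
  s' * s'                 ≤⟨ m≤m+n _ a' ⟩
  s' * s' + a'            ∎
  where
  open ≤-Reasoning
  s = a + b
  s' = a' + b'

pair-injective : ∀ a b a' b' → pair a b ≡ pair a' b' → (a ≡ a') × (b ≡ b')
pair-injective a b a' b' e with <-cmp (a + b) (a' + b')
... | tri< lt _ _ = ⊥-elim (<-irrefl e (pair-< a b a' b' lt))
... | tri> _ _ gt = ⊥-elim (<-irrefl (sym e) (pair-< a' b' a b gt))
... | tri≈ _ same-sum _ = a≡a' , +-cancelˡ-≡ a b b' (trans same-sum (cong (_+ b') (sym a≡a')))
  where
  a≡a' : a ≡ a'
  a≡a' = +-cancelˡ-≡ ((a + b) * (a + b)) a a' (trans e (cong (λ z → z * z + a') (sym same-sum)))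

-- Both components are bounded by the code, so quantifiers over the
-- components of a code can be bounded.
≤pair₁ : ∀ a b → a ≤ pair a b
≤pair₁ a b = m≤n+m a _

≤pair₂ : ∀ a b → b ≤ pair a b
≤pair₂ a b = ≤-trans (m≤n+m b a) (≤-trans (n≤n² (a + b)) (m≤m+n _ a))
  where
  n≤n² : ∀ n → n ≤ n * n
  n≤n² zero = z≤n
  n≤n² (suc n) = m≤m*n (suc n) (suc n)

-- A matrix θ read in
-- context `ys , b , a , ρ` (m = length ys inner quantified values, then the
-- two values to be merged) becomes a matrix read in context `ys , w , ρ`,
-- which unpacks w = pair a b by two bounded quantifiers; `pairRen m` moves the
-- variables of θ to their places in the context `b , a , ys , w , ρ`.
pairRen : ℕ → ℕ → ℕ
pairRen zero zero = 0
pairRen zero (suc zero) = 1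
pairRen zero (suc (suc j)) = suc (suc (suc j))
pairRen (suc m) zero = 2
pairRen (suc m) (suc i) = skip₂ (pairRen m i)
  where
  -- make room at index 2, just above b and a, for the next entry of ys
  skip₂ : ℕ → ℕ
  skip₂ zero = zero
  skip₂ (suc zero) = suc zero
  skip₂ (suc (suc k)) = suc (suc (suc k))

pairRen-renames : ∀ ys b a w ρ →
  Renames (pairRen (length ys)) (b ∷ᵉ (a ∷ᵉ (ys ++ᵉ (w ∷ᵉ ρ)))) (ys ++ᵉ (b ∷ᵉ (a ∷ᵉ ρ)))
pairRen-renames [] b a w ρ zero = refl
pairRen-renames [] b a w ρ (suc zero) = refl
pairRen-renames [] b a w ρ (suc (suc j)) = refl
pairRen-renames (z ∷ ys) b a w ρ zero = refl
pairRen-renames (z ∷ ys) b a w ρ (suc i)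
  with pairRen (length ys) i | pairRen-renames ys b a w ρ i
... | zero | r = r
... | suc zero | r = r
... | suc (suc k) | r = r

mergeᶠ : Bool → ℕ → Δ₀ → Δ₀
mergeᶠ false m θ = ∀< (sucᵗ (var m)) (∀< (sucᵗ (var (suc m)))
  ((var (suc (suc m)) ≐ pairᵗ (var 1) (var 0)) ⇒ᶠ rename (pairRen m) θ))
mergeᶠ true m θ = ∃< (sucᵗ (var m)) (∃< (sucᵗ (var (suc m)))
  ((var (suc (suc m)) ≐ pairᵗ (var 1) (var 0)) ∧ᶠ rename (pairRen m) θ))

module _ (Y : Cantor) (θ : Δ₀) (ys : List ℕ) (ρ : Env) where
  private
    m = length ys

  ⟦merge⟧-pair : ∀ flag a b → ⟦ mergeᶠ flag m θ ⟧ Y (ys ++ᵉ (pair a b ∷ᵉ ρ)) ⇔ ⟦ θ ⟧ Y (ys ++ᵉ (b ∷ᵉ (a ∷ᵉ ρ)))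
  ⟦merge⟧-pair flag a b = body flag
    where
    at : (ys ++ᵉ (pair a b ∷ᵉ ρ)) m ≡ pair a b
    at = ++ᵉ-at ys (pair a b) ρ
    a<w : a < suc ((ys ++ᵉ (pair a b ∷ᵉ ρ)) m)
    a<w = subst (a <_) (cong suc (sym at)) (s≤s (≤pair₁ a b))
    b<w : b < suc ((ys ++ᵉ (pair a b ∷ᵉ ρ)) m)
    b<w = subst (b <_) (cong suc (sym at)) (s≤s (≤pair₂ a b))
    θ-renamed : ⟦ rename (pairRen m) θ ⟧ Y _ ⇔ ⟦ θ ⟧ Y (ys ++ᵉ (b ∷ᵉ (a ∷ᵉ ρ)))
    θ-renamed = ⟦rename⟧ Y (pairRen m) θ (pairRen-renames ys b a (pair a b) ρ)
    body : ∀ flag → ⟦ mergeᶠ flag m θ ⟧ Y (ys ++ᵉ (pair a b ∷ᵉ ρ)) ⇔ ⟦ θ ⟧ Y (ys ++ᵉ (b ∷ᵉ (a ∷ᵉ ρ)))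
    body false = mk⇔ forth back
      where
      forth : ⟦ mergeᶠ false m θ ⟧ Y (ys ++ᵉ (pair a b ∷ᵉ ρ)) → ⟦ θ ⟧ Y (ys ++ᵉ (b ∷ᵉ (a ∷ᵉ ρ)))
      forth f with f a a<w b b<w
      ... | inj₁ w≢pair = ⊥-elim (w≢pair at)
      ... | inj₂ t = to θ-renamed t
      back : ⟦ θ ⟧ Y (ys ++ᵉ (b ∷ᵉ (a ∷ᵉ ρ))) → ⟦ mergeᶠ false m θ ⟧ Y (ys ++ᵉ (pair a b ∷ᵉ ρ))
      back t a' _ b' _ with (ys ++ᵉ (pair a b ∷ᵉ ρ)) m ≟ pair a' b'
      ... | no ne = inj₁ ne
      ... | yes e with pair-injective a b a' b' (trans (sym at) e)
      ...   | refl , refl = inj₂ (from θ-renamed t)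
    body true = mk⇔ forth back
      where
      forth : ⟦ mergeᶠ true m θ ⟧ Y (ys ++ᵉ (pair a b ∷ᵉ ρ)) → ⟦ θ ⟧ Y (ys ++ᵉ (b ∷ᵉ (a ∷ᵉ ρ)))
      forth (a' , _ , b' , _ , e , t) with pair-injective a b a' b' (trans (sym at) e)
      ... | refl , refl = to θ-renamed t
      back : ⟦ θ ⟧ Y (ys ++ᵉ (b ∷ᵉ (a ∷ᵉ ρ))) → ⟦ mergeᶠ true m θ ⟧ Y (ys ++ᵉ (pair a b ∷ᵉ ρ))
      back t = a , a<w , b , b<w , at , from θ-renamed t

  ⟦merge⟧-nonpair : ∀ w → ¬ (Σ ℕ λ a → Σ ℕ λ b → w ≡ pair a b) →
    ⟦ mergeᶠ false m θ ⟧ Y (ys ++ᵉ (w ∷ᵉ ρ)) × ¬ ⟦ mergeᶠ true m θ ⟧ Y (ys ++ᵉ (w ∷ᵉ ρ))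
  ⟦merge⟧-nonpair w not-pair =
      (λ a' _ b' _ → inj₁ (λ e → not-pair (a' , b' , trans (sym (++ᵉ-at ys w ρ)) e)))
    , (λ (a' , _ , b' , _ , e , _) → not-pair (a' , b' , trans (sym (++ᵉ-at ys w ρ)) e))

-- Three-fold merging, as used for quantifying over (coded) forcing conditions.
merge³ : Bool → ℕ → Δ₀ → Δ₀
merge³ flag m θ = mergeᶠ flag m (mergeᶠ flag m (mergeᶠ flag m θ))

module Classical (em : ExcludedMiddle 0ℓ) where

  dne : ∀ {A : Set} → ¬ ¬ A → A
  dne {A} nn with em {A}
  ... | yes a = a
  ... | no na = ⊥-elim (nn na)

  QSat-¬ : ∀ m b θ Y ρ → (¬ QSat m b θ Y ρ) ⇔ QSat m (not b) (¬ᶠ θ) Y ρ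
  QSat-¬ zero b θ Y ρ = ⇔.refl
  QSat-¬ (suc m) true θ Y ρ = mk⇔
    (λ h y → to (QSat-¬ m false θ Y (y ∷ᵉ ρ)) (λ q → h (y , q)))
    (λ f (y , q) → from (QSat-¬ m false θ Y (y ∷ᵉ ρ)) (f y) q)
  QSat-¬ (suc m) false θ Y ρ = mk⇔ forth back
    where
    forth : ¬ QSat (suc m) false θ Y ρ → QSat (suc m) true (¬ᶠ θ) Y ρ
    forth h with em {Σ ℕ λ y → ¬ QSat m true θ Y (y ∷ᵉ ρ)}
    ... | yes (y , nq) = y , to (QSat-¬ m true θ Y (y ∷ᵉ ρ)) nq
    ... | no n = ⊥-elim (h (λ y → dne (λ nq → n (y , nq))))
    back : QSat (suc m) true (¬ᶠ θ) Y ρ → ¬ QSat (suc m) false θ Y ρ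
    back (y , q) f = from (QSat-¬ m true θ Y (y ∷ᵉ ρ)) q (f y)

  QSat-guard⇒ : ∀ m b A θ Y ρ → (⟦ A ⟧ Y ρ → QSat m b θ Y ρ) ⇔ QSat m b (weaken m A ⇒ᶠ θ) Y ρ
  QSat-guard⇒ m b A θ Y ρ with em {⟦ A ⟧ Y ρ}
  ... | yes a = mk⇔ (λ f → to guarded (f a)) (λ q _ → from guarded q)
    where
    guarded : QSat m b θ Y ρ ⇔ QSat m b (weaken m A ⇒ᶠ θ) Y ρ
    guarded = QSat-cong m b θ (weaken m A ⇒ᶠ θ) Y Y ρ ρ λ ys len → mk⇔ inj₂
      λ { (inj₁ ¬A) → ⊥-elim (¬A (from (⟦weaken⟧ Y A ys ρ m len) a)) ; (inj₂ t) → t }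
  ... | no ¬a = mk⇔
    (λ _ → QSat-valid m b _ Y ρ (λ ys len → inj₁ (λ w → ¬a (to (⟦weaken⟧ Y A ys ρ m len) w))))
    (λ _ a → ⊥-elim (¬a a))

  QSat-guard∧ : ∀ m b A θ Y ρ → (⟦ A ⟧ Y ρ × QSat m b θ Y ρ) ⇔ QSat m b (weaken m A ∧ᶠ θ) Y ρ
  QSat-guard∧ m b A θ Y ρ with em {⟦ A ⟧ Y ρ}
  ... | yes a = mk⇔ (λ (_ , q) → to guarded q) (λ q → a , from guarded q)
    where
    guarded : QSat m b θ Y ρ ⇔ QSat m b (weaken m A ∧ᶠ θ) Y ρ
    guarded = QSat-cong m b θ (weaken m A ∧ᶠ θ) Y Y ρ ρ λ ys len →
      mk⇔ (λ t → from (⟦weaken⟧ Y A ys ρ m len) a , t) proj₂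
  ... | no ¬a = mk⇔ (λ (a , _) → ⊥-elim (¬a a))
    (λ q → ⊥-elim (QSat-unsat m b _ Y ρ (λ ys len (w , _) → ¬a (to (⟦weaken⟧ Y A ys ρ m len) w)) q))

  IsPair : ℕ → Set
  IsPair w = Σ ℕ λ a → Σ ℕ λ b → w ≡ pair a b

  merge-∀ : ∀ m b' θ Y ρ → ((a b : ℕ) → QSat m b' θ Y (b ∷ᵉ (a ∷ᵉ ρ))) ⇔
                           ((w : ℕ) → QSat m b' (mergeᶠ false m θ) Y (w ∷ᵉ ρ))
  merge-∀ m b' θ Y ρ = mk⇔ forth (λ g a b → to (at-pair a b) (g (pair a b)))
    where
    at-pair : ∀ a b → QSat m b' (mergeᶠ false m θ) Y (pair a b ∷ᵉ ρ) ⇔ QSat m b' θ Y (b ∷ᵉ (a ∷ᵉ ρ))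
    at-pair a b = QSat-cong m b' _ θ Y Y _ _ λ { ys refl → ⟦merge⟧-pair Y θ ys ρ false a b }
    forth : ((a b : ℕ) → QSat m b' θ Y (b ∷ᵉ (a ∷ᵉ ρ))) → (w : ℕ) → QSat m b' (mergeᶠ false m θ) Y (w ∷ᵉ ρ)
    forth f w with em {IsPair w}
    ... | yes (a , b , refl) = from (at-pair a b) (f a b)
    ... | no not-pair = QSat-valid m b' _ Y (w ∷ᵉ ρ) λ { ys refl → proj₁ (⟦merge⟧-nonpair Y θ ys ρ w not-pair) }

  merge-∃ : ∀ m b' θ Y ρ → (Σ ℕ λ a → Σ ℕ λ b → QSat m b' θ Y (b ∷ᵉ (a ∷ᵉ ρ))) ⇔
                           (Σ ℕ λ w → QSat m b' (mergeᶠ true m θ) Y (w ∷ᵉ ρ))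
  merge-∃ m b' θ Y ρ = mk⇔ (λ (a , b , q) → pair a b , from (at-pair a b) q) back
    where
    at-pair : ∀ a b → QSat m b' (mergeᶠ true m θ) Y (pair a b ∷ᵉ ρ) ⇔ QSat m b' θ Y (b ∷ᵉ (a ∷ᵉ ρ))
    at-pair a b = QSat-cong m b' _ θ Y Y _ _ λ { ys refl → ⟦merge⟧-pair Y θ ys ρ true a b }
    back : (Σ ℕ λ w → QSat m b' (mergeᶠ true m θ) Y (w ∷ᵉ ρ)) → Σ ℕ λ a → Σ ℕ λ b → QSat m b' θ Y (b ∷ᵉ (a ∷ᵉ ρ))
    back (w , q) with em {IsPair w}
    ... | yes (a , b , refl) = a , b , to (at-pair a b) q
    ... | no not-pair = ⊥-elim (QSat-unsat m b' _ Y (w ∷ᵉ ρ)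
                          (λ { ys refl → proj₂ (⟦merge⟧-nonpair Y θ ys ρ w not-pair) }) q)

  merge-∀⁴ : ∀ m b θ Y ρ →
    ((y s d l : ℕ) → QSat m b θ Y (l ∷ᵉ (d ∷ᵉ (s ∷ᵉ (y ∷ᵉ ρ))))) ⇔ ((w : ℕ) → QSat m b (merge³ false m θ) Y (w ∷ᵉ ρ))
  merge-∀⁴ m b θ Y ρ = begin
    ((y s d l : ℕ) → QSat m b θ Y (l ∷ᵉ (d ∷ᵉ (s ∷ᵉ (y ∷ᵉ ρ)))))
      ≈⟨ ∀-⇔ (λ y → ∀-⇔ λ s → merge-∀ m b θ Y (s ∷ᵉ (y ∷ᵉ ρ))) ⟩
    ((y s w : ℕ) → QSat m b (mergeᶠ false m θ) Y (w ∷ᵉ (s ∷ᵉ (y ∷ᵉ ρ))))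
      ≈⟨ ∀-⇔ (λ y → merge-∀ m b _ Y (y ∷ᵉ ρ)) ⟩
    ((y w : ℕ) → QSat m b (mergeᶠ false m (mergeᶠ false m θ)) Y (w ∷ᵉ (y ∷ᵉ ρ)))
      ≈⟨ merge-∀ m b _ Y ρ ⟩
    ((w : ℕ) → QSat m b (merge³ false m θ) Y (w ∷ᵉ ρ)) ∎
    where open import Relation.Binary.Reasoning.Setoid (⇔-setoid 0ℓ)

  merge-∃⁴ : ∀ m b θ Y ρ →
    (Σ ℕ λ y → Σ ℕ λ s → Σ ℕ λ d → Σ ℕ λ l → QSat m b θ Y (l ∷ᵉ (d ∷ᵉ (s ∷ᵉ (y ∷ᵉ ρ))))) ⇔
    (Σ ℕ λ w → QSat m b (merge³ true m θ) Y (w ∷ᵉ ρ))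
  merge-∃⁴ m b θ Y ρ = begin
    (Σ ℕ λ y → Σ ℕ λ s → Σ ℕ λ d → Σ ℕ λ l → QSat m b θ Y (l ∷ᵉ (d ∷ᵉ (s ∷ᵉ (y ∷ᵉ ρ)))))
      ≈⟨ ∃-⇔ (λ y → ∃-⇔ λ s → merge-∃ m b θ Y (s ∷ᵉ (y ∷ᵉ ρ))) ⟩
    (Σ ℕ λ y → Σ ℕ λ s → Σ ℕ λ w → QSat m b (mergeᶠ true m θ) Y (w ∷ᵉ (s ∷ᵉ (y ∷ᵉ ρ))))
      ≈⟨ ∃-⇔ (λ y → merge-∃ m b _ Y (y ∷ᵉ ρ)) ⟩
    (Σ ℕ λ y → Σ ℕ λ w → QSat m b (mergeᶠ true m (mergeᶠ true m θ)) Y (w ∷ᵉ (y ∷ᵉ ρ)))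
      ≈⟨ merge-∃ m b _ Y ρ ⟩
    (Σ ℕ λ w → QSat m b (merge³ true m θ) Y (w ∷ᵉ ρ)) ∎
    where open import Relation.Binary.Reasoning.Setoid (⇔-setoid 0ℓ)

-- Forcing conditions: finite bit strings, given by a length and a function of
-- which only the values below the length matter.
record Cond : Set where
  constructor cond
  field
    len  : ℕ
    bits : Cantor
open Cond

_≺_ : Cond → Cantor → Set
c ≺ G = AgreeBelow (len c) (bits c) G

_⊑_ : Cond → Cond → Set
c ⊑ c' = (len c ≤ len c') × AgreeBelow (len c) (bits c) (bits c')

⊑-refl : ∀ c → c ⊑ c
⊑-refl c = ≤-refl , λ i _ → refl

⊑-trans : ∀ {c c' c''} → c ⊑ c' → c' ⊑ c'' → c ⊑ c''
⊑-trans (le , a) (le' , a') = ≤-trans le le' , λ i p → trans (a i p) (a' i (<-≤-trans p le))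

⊑-≺ : ∀ {c c' G} → c ⊑ c' → c' ≺ G → c ≺ G
⊑-≺ (le , a) a' i p = trans (a i p) (a' i (<-≤-trans p le))

≺-self : ∀ c → c ≺ bits c
≺-self c i p = refl

join : Cond → Cond → Cantor → Cond
join c c' G = cond (len c ⊔ len c') G

join-ext₁ : ∀ c c' G → c ≺ G → c ⊑ join c c' G
join-ext₁ c c' G a = m≤m⊔n _ _ , a

join-ext₂ : ∀ c c' G → c' ≺ G → c' ⊑ join c c' G
join-ext₂ c c' G a = m≤n⊔m _ _ , a

-- Gödel's β-function: relative to d, the number s codes the bit string
-- h ↦ [βmod d h ∣ s].  This makes conditions codable by pairs of numbers.
βmod : ℕ → ℕ → ℕ
βmod d h = suc (suc h * d)

βbit : ℕ → ℕ → Cantor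
βbit d s h = does (βmod d h ∣? s)

βbit⇒∣ : ∀ d s h → βbit d s h ≡ true → βmod d h ∣ s
βbit⇒∣ d s h = does⇒ (βmod d h ∣? s)
  where
  does⇒ : ∀ {A : Set} (a? : Dec A) → does a? ≡ true → A
  does⇒ (yes a) _ = a
  does⇒ (no _) ()

∣⇒βbit : ∀ d s h → βmod d h ∣ s → βbit d s h ≡ true
∣⇒βbit d s h = dec-true (βmod d h ∣? s)

codedCond : ℕ → ℕ → ℕ → Cond
codedCond l d s = cond l (βbit d s)

-- For d > 0 no modulus is 1, so the empty product codes the empty set of bits.
βmod-nontrivial : ∀ d h → d > 0 → ¬ (βmod d h ∣ 1)
βmod-nontrivial d h d>0 p with m*n≡0⇒m≡0∨n≡0 (suc h) (suc-injective (∣1⇒≡1 p))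
... | inj₂ refl = <-irrefl refl d>0

-- Moduli whose indices differ by a divisor of d are coprime: a common divisor
-- g divides their difference (k+1)·d, is coprime to d (as it divides
-- 1 + (i+1)·d), hence divides k+1 and so d, and therefore g = 1.
βmod-coprime : ∀ d i k → suc k ∣ d → Coprime (βmod d i) (βmod d (i + suc k))
βmod-coprime d i k k∣d {g} (g∣mᵢ , g∣mⱼ) = g⊥d (∣-refl , ∣-trans g∣k k∣d)
  where
  difference : βmod d (i + suc k) ≡ βmod d i + suc k * d
  difference = cong suc (*-distribʳ-+ d (suc i) (suc k))
  g⊥d : Coprime g d
  g⊥d {h} (h∣g , h∣d) = ∣1⇒≡1 (∣m+n∣m⇒∣n (subst (h ∣_) (+-comm 1 (suc i * d)) (∣-trans h∣g g∣mᵢ))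
                                          (∣n⇒∣m*n (suc i) h∣d))
  g∣k : g ∣ suc k
  g∣k = coprime-divisor g⊥d (subst (g ∣_) (*-comm (suc k) d)
          (∣m+n∣m⇒∣n (subst (g ∣_) difference g∣mⱼ) g∣mᵢ))

-- Every bit string f of length n is βbit-coded, using d = n!: the moduli
-- βmod d i for i < n are pairwise coprime, and s is the product of those
-- whose bit is set.
module StringCode (n : ℕ) (f : Cantor) where
  d : ℕ
  d = n !

  -- indices i < j < n differ by j - i ≤ n, a divisor of n!
  coprime-below : ∀ i j → i < j → j < n → Coprime (βmod d i) (βmod d j)
  coprime-below i j i<j j<n = subst (λ z → Coprime (βmod d i) (βmod d z)) i+[j-i]≡j
    (βmod-coprime d i (j ∸ suc i) (∣-trans (m∣m*n ((j ∸ suc i) !)) (m≤n⇒m!∣n! j-i≤n)))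
    where
    i+[j-i]≡j : i + suc (j ∸ suc i) ≡ j
    i+[j-i]≡j = trans (+-suc i _) (m+[n∸m]≡n i<j)
    j-i≤n : suc (j ∸ suc i) ≤ n
    j-i≤n = ≤-trans (s≤s (m∸n≤m j (suc i))) j<n

  product : ℕ → ℕ
  product zero = 1
  product (suc k) = if f k then βmod d k * product k else product k

  -- A set bit's modulus divides the product, and by coprimality no other
  -- modulus below n does.
  selected∣product : ∀ k i → i < k → f i ≡ true → βmod d i ∣ product k
  selected∣product (suc k) i i<1+k fᵢ with m<1+n⇒m<n∨m≡n i<1+k | f k in fₖ
  ... | inj₂ refl | true = m∣m*n (product i)
  ... | inj₁ i<k | true = ∣n⇒∣m*n (βmod d k) (selected∣product k i i<k fᵢ)
  ... | inj₁ i<k | false = selected∣product k i i<k fᵢ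
  ... | inj₂ refl | false with trans (sym fₖ) fᵢ
  ...   | ()

  ∣product⇒selected : ∀ k → k ≤ n → ∀ i → i < n → βmod d i ∣ product k → f i ≡ true
  ∣product⇒selected zero _ i _ p = ⊥-elim (βmod-nontrivial d i (1≤n! n) p)
  ∣product⇒selected (suc k) k<n i i<n p with f k in fₖ
  ... | false = ∣product⇒selected k (<⇒≤ k<n) i i<n p
  ... | true with <-cmp i k
  ...   | tri≈ _ refl _ = fₖ
  ...   | tri< i<k _ _ = ∣product⇒selected k (<⇒≤ k<n) i i<n (coprime-divisor (coprime-below i k i<k k<n) p)
  ...   | tri> _ _ k<i = ∣product⇒selected k (<⇒≤ k<n) i i<n
                           (coprime-divisor (Coprime.sym (coprime-below k i k<i i<n)) p)

  decodes : AgreeBelow n f (βbit d (product n))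
  decodes i i<n with f i in fᵢ | βbit d (product n) i in bᵢ
  ... | true | true = refl
  ... | false | false = refl
  ... | true | false with trans (sym (∣⇒βbit d (product n) i (selected∣product n i i<n fᵢ))) bᵢ
  ...   | ()
  decodes i i<n | false | true with trans (sym (∣product⇒selected n ≤-refl i i<n (βbit⇒∣ d (product n) i bᵢ))) fᵢ
  ...   | ()

coded-extension : ∀ c → Σ ℕ λ d → Σ ℕ λ s → c ⊑ codedCond (len c) d s
coded-extension (cond n f) = StringCode.d n f , StringCode.product n f n , ≤-refl , StringCode.decodes n f

h+h≡h*2 : ∀ h → h + h ≡ h * 2
h+h≡h*2 h = trans (cong (h +_) (sym (+-identityʳ h))) (*-comm 2 h)

⊕-even : ∀ X G h → (X ⊕ G) (h + h) ≡ X h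
⊕-even X G h rewrite h+h≡h*2 h = trans (at-even (h * 2) (m*n%n≡0 h 2)) (cong X (m*n/n≡m h 2))
  where
  at-even : ∀ m → m % 2 ≡ 0 → (X ⊕ G) m ≡ X (m / 2)
  at-even m e with m % 2
  ... | zero = refl
  ... | suc _ with e
  ...   | ()

⊕-odd : ∀ X G h → (X ⊕ G) (suc (h + h)) ≡ G h
⊕-odd X G h rewrite h+h≡h*2 h = trans (at-odd (1 + h * 2) ([m+kn]%n≡m%n 1 h 2))
  (cong G (trans (+-distrib-/ 1 (h * 2) (subst (λ z → 1 + z < 2) (sym (m*n%n≡0 h 2)) (s≤s (s≤s z≤n))))
                 (m*n/n≡m h 2)))
  where
  at-odd : ∀ m → m % 2 ≡ 1 → (X ⊕ G) m ≡ G (m / 2)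
  at-odd m e with m % 2
  ... | zero with e
  ...   | ()
  at-odd m e | suc _ = refl

halve : ∀ m → Σ ℕ λ h → h ≤ m × (m ≡ h + h ⊎ m ≡ suc (h + h))
halve zero = 0 , z≤n , inj₁ refl
halve (suc m) with halve m
... | h , h≤m , inj₁ e = h , ≤-trans h≤m (n≤1+n m) , inj₂ (cong suc e)
... | h , h≤m , inj₂ e = suc h , s≤s h≤m , inj₁ (cong suc (trans e (sym (+-suc h h))))

⊕-agree : ∀ X {N F H} → AgreeBelow N F H → AgreeBelow N (X ⊕ F) (X ⊕ H)
⊕-agree X {N} {F} {H} a m m<N with halve m
... | h , h≤m , inj₁ refl = trans (⊕-even X F h) (sym (⊕-even X H h))
... | h , h≤m , inj₂ refl = trans (⊕-odd X F h) (trans (a h (≤-<-trans h≤m m<N)) (sym (⊕-odd X H h)))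

numeral : ℕ → Term
numeral zero = zro
numeral (suc n) = sucᵗ (numeral n)

evalᵗ-numeral : ∀ ρ n → evalᵗ ρ (numeral n) ≡ n
evalᵗ-numeral ρ zero = refl
evalᵗ-numeral ρ (suc n) = cong suc (evalᵗ-numeral ρ n)

↑ᵗ : Term → Term
↑ᵗ = renameᵗ suc

evalᵗ-↑ : ∀ y ρ t → evalᵗ (y ∷ᵉ ρ) (↑ᵗ t) ≡ evalᵗ ρ t
evalᵗ-↑ y ρ t = evalᵗ-rename {ρ = y ∷ᵉ ρ} {ρ' = ρ} (λ i → refl) t

BitF : Term → Term → Term → Δ₀
BitF h d s = ∃< (sucᵗ s) ((var 0 *ᵗ sucᵗ (sucᵗ (↑ᵗ h) *ᵗ ↑ᵗ d)) ≐ ↑ᵗ s)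

⟦BitF⟧ : ∀ Y ρ h d s → ⟦ BitF h d s ⟧ Y ρ ⇔ (βbit (evalᵗ ρ d) (evalᵗ ρ s) (evalᵗ ρ h) ≡ true)
⟦BitF⟧ Y ρ h d s = mk⇔ (λ b → ∣⇒βbit D S H (forth b)) (λ e → back (βbit⇒∣ D S H e))
  where
  D = evalᵗ ρ d
  S = evalᵗ ρ s
  H = evalᵗ ρ h
  modulus-under-q : ∀ q → q * suc (suc (evalᵗ (q ∷ᵉ ρ) (↑ᵗ h)) * evalᵗ (q ∷ᵉ ρ) (↑ᵗ d)) ≡ q * βmod D H
  modulus-under-q q = cong₂ (λ a b → q * suc (suc a * b)) (evalᵗ-↑ q ρ h) (evalᵗ-↑ q ρ d)
  forth : ⟦ BitF h d s ⟧ Y ρ → βmod D H ∣ S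
  forth (q , _ , e) = divides q (trans (sym (evalᵗ-↑ q ρ s)) (trans (sym e) (modulus-under-q q)))
  back : βmod D H ∣ S → ⟦ BitF h d s ⟧ Y ρ
  back (divides q e) = q , s≤s (subst (q ≤_) (sym e) (m≤m*n q (βmod D H))) ,
                       trans (modulus-under-q q) (trans (sym e) (sym (evalᵗ-↑ q ρ s)))

⟦BitF⟧₀ : ∀ Y ρ i d s → ⟦ BitF (var 0) (↑ᵗ d) (↑ᵗ s) ⟧ Y (i ∷ᵉ ρ) ⇔ (βbit (evalᵗ ρ d) (evalᵗ ρ s) i ≡ true)
⟦BitF⟧₀ Y ρ i d s = ⇔.trans (⟦BitF⟧ Y (i ∷ᵉ ρ) (var 0) (↑ᵗ d) (↑ᵗ s))
  (≡⇒⇔ (cong₂ (λ a b → βbit a b i ≡ true) (evalᵗ-↑ i ρ d) (evalᵗ-↑ i ρ s)))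

MemF : Term → ℕ → ℕ → Δ₀
MemF T iD iS = ∃< (sucᵗ T) (((↑ᵗ T ≐ (var 0 +ᵗ var 0)) ∧ᶠ mem (var 0)) ∨ᶠ
                            ((↑ᵗ T ≐ sucᵗ (var 0 +ᵗ var 0)) ∧ᶠ BitF (var 0) (var (suc iD)) (var (suc iS))))

⟦MemF⟧ : ∀ X ρ T iD iS → ⟦ MemF T iD iS ⟧ X ρ ⇔ ((X ⊕ βbit (ρ iD) (ρ iS)) (evalᵗ ρ T) ≡ true)
⟦MemF⟧ X ρ T iD iS = mk⇔ forth back
  where
  H = βbit (ρ iD) (ρ iS)
  v = evalᵗ ρ T
  bit : ∀ h → ⟦ BitF (var 0) (var (suc iD)) (var (suc iS)) ⟧ X (h ∷ᵉ ρ) ⇔ (H h ≡ true)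
  bit h = ⟦BitF⟧ X (h ∷ᵉ ρ) (var 0) (var (suc iD)) (var (suc iS))
  forth : ⟦ MemF T iD iS ⟧ X ρ → (X ⊕ H) v ≡ true
  forth (h , _ , inj₁ (e , x)) rewrite sym (evalᵗ-↑ h ρ T) | e = trans (⊕-even X H h) x
  forth (h , _ , inj₂ (e , b)) rewrite sym (evalᵗ-↑ h ρ T) | e = trans (⊕-odd X H h) (to (bit h) b)
  back : (X ⊕ H) v ≡ true → ⟦ MemF T iD iS ⟧ X ρ
  back t with halve v
  ... | h , h≤v , inj₁ e = h , s≤s h≤v , inj₁ (trans (evalᵗ-↑ h ρ T) e ,
          trans (sym (⊕-even X H h)) (subst (λ z → (X ⊕ H) z ≡ true) e t))
  ... | h , h≤v , inj₂ e = h , s≤s h≤v , inj₂ (trans (evalᵗ-↑ h ρ T) e ,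
          from (bit h) (trans (sym (⊕-odd X H h)) (subst (λ z → (X ⊕ H) z ≡ true) e t)))

translate : (ℕ → ℕ) → ℕ → ℕ → Δ₀ → Δ₀
translate g iD iS (s ≐ t) = renameᵗ g s ≐ renameᵗ g t
translate g iD iS (s <ᶠ t) = renameᵗ g s <ᶠ renameᵗ g t
translate g iD iS (mem t) = MemF (renameᵗ g t) iD iS
translate g iD iS (¬ᶠ φ) = ¬ᶠ translate g iD iS φ
translate g iD iS (φ ∧ᶠ ψ) = translate g iD iS φ ∧ᶠ translate g iD iS ψ
translate g iD iS (φ ∨ᶠ ψ) = translate g iD iS φ ∨ᶠ translate g iD iS ψ
translate g iD iS (∀< t φ) = ∀< (renameᵗ g t) (translate (liftRen g) (suc iD) (suc iS) φ)
translate g iD iS (∃< t φ) = ∃< (renameᵗ g t) (translate (liftRen g) (suc iD) (suc iS) φ)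

⟦translate⟧ : ∀ X g iD iS θ {ρ ρ'} → Renames g ρ ρ' →
  ⟦ translate g iD iS θ ⟧ X ρ ⇔ ⟦ θ ⟧ (X ⊕ βbit (ρ iD) (ρ iS)) ρ'
⟦translate⟧ X g iD iS (s ≐ t) r = ≡⇒⇔ (cong₂ _≡_ (evalᵗ-rename r s) (evalᵗ-rename r t))
⟦translate⟧ X g iD iS (s <ᶠ t) r = ≡⇒⇔ (cong₂ _<_ (evalᵗ-rename r s) (evalᵗ-rename r t))
⟦translate⟧ X g iD iS (mem t) {ρ} r = ⇔.trans (⟦MemF⟧ X ρ (renameᵗ g t) iD iS)
  (≡⇒⇔ (cong (λ v → (X ⊕ βbit (ρ iD) (ρ iS)) v ≡ true) (evalᵗ-rename r t)))
⟦translate⟧ X g iD iS (¬ᶠ θ) r = ¬-cong-⇔ (⟦translate⟧ X g iD iS θ r)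
⟦translate⟧ X g iD iS (θ ∧ᶠ φ) r = ⟦translate⟧ X g iD iS θ r ×-⇔ ⟦translate⟧ X g iD iS φ r
⟦translate⟧ X g iD iS (θ ∨ᶠ φ) r = ⟦translate⟧ X g iD iS θ r ⊎-⇔ ⟦translate⟧ X g iD iS φ r
⟦translate⟧ X g iD iS (∀< t θ) r =
  ∀<-⇔ (evalᵗ-rename r t) (λ y _ → ⟦translate⟧ X (liftRen g) (suc iD) (suc iS) θ (Renames-lift y r))
⟦translate⟧ X g iD iS (∃< t θ) r =
  ∃<-⇔ (evalᵗ-rename r t) (λ y _ → ⟦translate⟧ X (liftRen g) (suc iD) (suc iS) θ (Renames-lift y r))

bool-agree : ∀ b b' → ((b ≡ true × b' ≡ true) ⊎ (¬ b ≡ true × ¬ b' ≡ true)) ⇔ (b ≡ b')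
bool-agree true true = mk⇔ (λ _ → refl) (λ _ → inj₁ (refl , refl))
bool-agree false false = mk⇔ (λ _ → refl) (λ _ → inj₂ ((λ ()) , (λ ())))
bool-agree true false = mk⇔ (λ { (inj₁ (_ , ())) ; (inj₂ (t , _)) → ⊥-elim (t refl) }) (λ ())
bool-agree false true = mk⇔ (λ { (inj₁ (() , _)) ; (inj₂ (_ , t)) → ⊥-elim (t refl) }) (λ ())

ExtF : Term → Term → Term → Term → Term → Term → Δ₀
ExtF l d s l' d' s' = (l <ᶠ sucᵗ l') ∧ᶠ ∀< l ((B ∧ᶠ B') ∨ᶠ ((¬ᶠ B) ∧ᶠ (¬ᶠ B')))
  where
  B = BitF (var 0) (↑ᵗ d) (↑ᵗ s)
  B' = BitF (var 0) (↑ᵗ d') (↑ᵗ s')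

⟦ExtF⟧ : ∀ Y ρ l d s l' d' s' → ⟦ ExtF l d s l' d' s' ⟧ Y ρ ⇔
  (codedCond (evalᵗ ρ l) (evalᵗ ρ d) (evalᵗ ρ s) ⊑ codedCond (evalᵗ ρ l') (evalᵗ ρ d') (evalᵗ ρ s'))
⟦ExtF⟧ Y ρ l d s l' d' s' = mk⇔ ≤-pred s≤s ×-⇔ ∀<-⇔ refl λ i _ →
  ⇔.trans ((B i ×-⇔ B' i) ⊎-⇔ (¬-cong-⇔ (B i) ×-⇔ ¬-cong-⇔ (B' i))) (bool-agree _ _)
  where
  B = λ i → ⟦BitF⟧₀ Y ρ i d s
  B' = λ i → ⟦BitF⟧₀ Y ρ i d' s'

Enumeration : Set → Set
Enumeration T = Σ (ℕ → T) λ f → ∀ t → Σ ℕ λ n → f n ≡ t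

diagonal-step : ℕ × ℕ → ℕ × ℕ
diagonal-step (a , zero) = zero , suc a
diagonal-step (a , suc b) = suc a , b

unpair : ℕ → ℕ × ℕ
unpair zero = zero , zero
unpair (suc n) = diagonal-step (unpair n)

unpair-walk : ∀ j n a b → unpair n ≡ (a , b + j) → unpair (n + j) ≡ (a + j , b)
unpair-walk zero n a b e rewrite +-identityʳ n | +-identityʳ a | +-identityʳ b = e
unpair-walk (suc j) n a b e rewrite +-suc n j | +-suc a j =
  unpair-walk j (suc n) (suc a) b (trans (cong diagonal-step e) (cong (λ z → diagonal-step (a , z)) (+-suc b j)))

unpair-diagonal : ∀ s → Σ ℕ λ n → unpair n ≡ (0 , s)
unpair-diagonal zero = 0 , refl
unpair-diagonal (suc s) with unpair-diagonal s
... | n , e = suc (n + s) , cong diagonal-step (unpair-walk s n 0 0 e)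

unpair-onto : ∀ a b → Σ ℕ λ n → unpair n ≡ (a , b)
unpair-onto a b with unpair-diagonal (a + b)
... | n , e = n + a , unpair-walk a n 0 b (trans e (cong (0 ,_) (+-comm a b)))

enum-ℕ : Enumeration ℕ
enum-ℕ = (λ n → n) , λ t → t , refl

enum-Bool : Enumeration Bool
enum-Bool = is-zero , λ { true → 0 , refl ; false → 1 , refl }
  where
  is-zero : ℕ → Bool
  is-zero zero = true
  is-zero (suc _) = false

enum-× : ∀ {A B} → Enumeration A → Enumeration B → Enumeration (A × B)
enum-× (fa , onto-a) (fb , onto-b) = decode , λ (a , b) → reach (onto-a a) (onto-b b)
  where
  decode : ℕ → _
  decode n = fa (proj₁ (unpair n)) , fb (proj₂ (unpair n))
  reach : ∀ {a b} → (Σ ℕ λ n → fa n ≡ a) → (Σ ℕ λ n → fb n ≡ b) → Σ ℕ λ n → decode n ≡ (a , b)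
  reach (na , refl) (nb , refl) with unpair-onto na nb
  ... | n , e = n , cong (λ (i , j) → fa i , fb j) e

decodeList : ℕ → ℕ → List ℕ
decodeList zero c = []
decodeList (suc k) c = proj₁ (unpair c) ∷ decodeList k (proj₂ (unpair c))

encodeList : ∀ zs → Σ ℕ λ c → decodeList (length zs) c ≡ zs
encodeList [] = 0 , refl
encodeList (z ∷ zs) with encodeList zs
... | c' , e' with unpair-onto z c'
...   | c , e = c , cong₂ _∷_ (cong proj₁ e) (trans (cong (λ p → decodeList (length zs) (proj₂ p)) e) e')

enum-List : Enumeration (List ℕ)
enum-List = (λ n → decodeList (proj₁ (unpair n)) (proj₂ (unpair n))) , reach
  where
  reach : ∀ zs → Σ ℕ λ n → decodeList (proj₁ (unpair n)) (proj₂ (unpair n)) ≡ zs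
  reach zs with encodeList zs
  ... | c , e with unpair-onto (length zs) c
  ...   | n , en = n , trans (cong (λ (k , c') → decodeList k c') en) e

triple : ℕ → ℕ × ℕ × ℕ
triple c = proj₁ (unpair c) , unpair (proj₂ (unpair c))

triple-onto : ∀ t a b → Σ ℕ λ c → triple c ≡ (t , a , b)
triple-onto t a b with unpair-onto a b
... | r , er with unpair-onto t r
...   | c , ec = c , cong₂ _,_ (cong proj₁ ec) (trans (cong (λ p → unpair (proj₂ p)) ec) er)

mutual
  decodeTerm : ℕ → ℕ → Term
  decodeTerm zero c = zro
  decodeTerm (suc f) c = termNode f (triple c)

  termNode : ℕ → ℕ × ℕ × ℕ → Term
  termNode f (0 , a , b) = var a
  termNode f (1 , a , b) = zro
  termNode f (2 , a , b) = sucᵗ (decodeTerm f a)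
  termNode f (3 , a , b) = decodeTerm f a +ᵗ decodeTerm f b
  termNode f (_ , a , b) = decodeTerm f a *ᵗ decodeTerm f b

mutual
  decodeΔ₀ : ℕ → ℕ → Δ₀
  decodeΔ₀ zero c = zro ≐ zro
  decodeΔ₀ (suc f) c = formulaNode f (triple c)

  formulaNode : ℕ → ℕ × ℕ × ℕ → Δ₀
  formulaNode f (0 , a , b) = decodeTerm f a ≐ decodeTerm f b
  formulaNode f (1 , a , b) = decodeTerm f a <ᶠ decodeTerm f b
  formulaNode f (2 , a , b) = mem (decodeTerm f a)
  formulaNode f (3 , a , b) = ¬ᶠ decodeΔ₀ f a
  formulaNode f (4 , a , b) = decodeΔ₀ f a ∧ᶠ decodeΔ₀ f b
  formulaNode f (5 , a , b) = decodeΔ₀ f a ∨ᶠ decodeΔ₀ f b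
  formulaNode f (6 , a , b) = ∀< (decodeTerm f a) (decodeΔ₀ f b)
  formulaNode f (_ , a , b) = ∃< (decodeTerm f a) (decodeΔ₀ f b)

Encodable : ∀ {T : Set} → (ℕ → ℕ → T) → T → Set
Encodable decode t = Σ ℕ λ F → Σ ℕ λ c → ∀ f → F ≤ f → decode f c ≡ t

encodable-node : ∀ {A B T : Set} {decA : ℕ → ℕ → A} {decB : ℕ → ℕ → B}
  (decode : ℕ → ℕ → T) (node : A → B → T) {x y} →
  (∀ a b → Σ ℕ λ c → ∀ f → decode (suc f) c ≡ node (decA f a) (decB f b)) →
  Encodable decA x → Encodable decB y → Encodable decode (node x y)
encodable-node decode node tag (F₁ , c₁ , h₁) (F₂ , c₂ , h₂) with tag c₁ c₂
... | c , h = suc (F₁ ⊔ F₂) , c , λ { (suc f) F≤f →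
  trans (h f) (cong₂ node (h₁ f (≤-trans (m≤m⊔n F₁ F₂) (≤-pred F≤f))) (h₂ f (≤-trans (m≤n⊔m F₁ F₂) (≤-pred F≤f)))) }

-- (Unary nodes are treated as binary ones with an ignored second child.)
-- Leaves are encodable: nothing to decode below them.
encodable-leaf : ∀ {T : Set} (decode : ℕ → ℕ → T) {t} → (Σ ℕ λ c → ∀ f → decode (suc f) c ≡ t) → Encodable decode t
encodable-leaf decode (c , h) = 1 , c , λ { (suc f) _ → h f }

tagged : ∀ {T : Set} (node : ℕ → ℕ × ℕ × ℕ → T) t a b → Σ ℕ λ c → ∀ f → node f (triple c) ≡ node f (t , a , b)
tagged node t a b with triple-onto t a b
... | c , e = c , λ f → cong (node f) e

encodable-term : ∀ t → Encodable decodeTerm t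
encodable-term (var i) = encodable-leaf decodeTerm (tagged termNode 0 i 0)
encodable-term zro = encodable-leaf decodeTerm (tagged termNode 1 0 0)
encodable-term (sucᵗ t) = encodable-node decodeTerm (λ a _ → sucᵗ a) (tagged termNode 2) (encodable-term t) (encodable-term zro)
encodable-term (s +ᵗ t) = encodable-node decodeTerm _+ᵗ_ (tagged termNode 3) (encodable-term s) (encodable-term t)
encodable-term (s *ᵗ t) = encodable-node decodeTerm _*ᵗ_ (tagged termNode 4) (encodable-term s) (encodable-term t)

encodable-Δ₀ : ∀ φ → Encodable decodeΔ₀ φ
encodable-Δ₀ (s ≐ t) = encodable-node decodeΔ₀ _≐_ (tagged formulaNode 0) (encodable-term s) (encodable-term t)
encodable-Δ₀ (s <ᶠ t) = encodable-node decodeΔ₀ _<ᶠ_ (tagged formulaNode 1) (encodable-term s) (encodable-term t)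
encodable-Δ₀ (mem t) = encodable-node decodeΔ₀ (λ a _ → mem a) (tagged formulaNode 2) (encodable-term t) (encodable-term zro)
encodable-Δ₀ (¬ᶠ φ) = encodable-node decodeΔ₀ (λ a _ → ¬ᶠ a) (tagged formulaNode 3) (encodable-Δ₀ φ) (encodable-term zro)
encodable-Δ₀ (φ ∧ᶠ ψ) = encodable-node decodeΔ₀ _∧ᶠ_ (tagged formulaNode 4) (encodable-Δ₀ φ) (encodable-Δ₀ ψ)
encodable-Δ₀ (φ ∨ᶠ ψ) = encodable-node decodeΔ₀ _∨ᶠ_ (tagged formulaNode 5) (encodable-Δ₀ φ) (encodable-Δ₀ ψ)
encodable-Δ₀ (∀< t φ) = encodable-node decodeΔ₀ ∀< (tagged formulaNode 6) (encodable-term t) (encodable-Δ₀ φ)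
encodable-Δ₀ (∃< t φ) = encodable-node decodeΔ₀ ∃< (tagged formulaNode 7) (encodable-term t) (encodable-Δ₀ φ)

enum-Δ₀ : Enumeration Δ₀
enum-Δ₀ = (λ n → decodeΔ₀ (proj₁ (unpair n)) (proj₂ (unpair n))) , λ φ → reach (encodable-Δ₀ φ)
  where
  reach : ∀ {φ} → Encodable decodeΔ₀ φ → Σ ℕ λ n → decodeΔ₀ (proj₁ (unpair n)) (proj₂ (unpair n)) ≡ φ
  reach (F , c , h) with unpair-onto F c
  ... | n , e = n , trans (cong (λ (f , c') → decodeΔ₀ f c') e) (h F ≤-refl)

∁ : Cantor → Cantor
∁ A x = not (A x)

∈∁ : ∀ A x → (x ∈ˢ ∁ A) ⇔ (¬ x ∈ˢ A)
∈∁ A x with A x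
... | true = mk⇔ (λ ()) (λ ¬t → ⊥-elim (¬t refl))
... | false = mk⇔ (λ _ ()) (λ _ → refl)

∉∁ : ∀ A x → (x ∈ˢ A) ⇔ (¬ x ∈ˢ ∁ A)
∉∁ A x with A x
... | true = mk⇔ (λ _ ()) (λ _ → refl)
... | false = mk⇔ (λ ()) (λ ¬t → ⊥-elim (¬t refl))

-- `embed θ` says over X ⊕ G what θ says over X: it reads X from the even bits.
embed : Δ₀ → Δ₀
embed (s ≐ t) = s ≐ t
embed (s <ᶠ t) = s <ᶠ t
embed (mem t) = mem (t +ᵗ t)
embed (¬ᶠ φ) = ¬ᶠ embed φ
embed (φ ∧ᶠ ψ) = embed φ ∧ᶠ embed ψ
embed (φ ∨ᶠ ψ) = embed φ ∨ᶠ embed ψ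
embed (∀< t φ) = ∀< t (embed φ)
embed (∃< t φ) = ∃< t (embed φ)

⟦embed⟧ : ∀ X G θ ρ → ⟦ embed θ ⟧ (X ⊕ G) ρ ⇔ ⟦ θ ⟧ X ρ
⟦embed⟧ X G (s ≐ t) ρ = ⇔.refl
⟦embed⟧ X G (s <ᶠ t) ρ = ⇔.refl
⟦embed⟧ X G (mem t) ρ = ≡⇒⇔ (cong (_≡ true) (⊕-even X G (evalᵗ ρ t)))
⟦embed⟧ X G (¬ᶠ θ) ρ = ¬-cong-⇔ (⟦embed⟧ X G θ ρ)
⟦embed⟧ X G (θ ∧ᶠ φ) ρ = ⟦embed⟧ X G θ ρ ×-⇔ ⟦embed⟧ X G φ ρ
⟦embed⟧ X G (θ ∨ᶠ φ) ρ = ⟦embed⟧ X G θ ρ ⊎-⇔ ⟦embed⟧ X G φ ρ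
⟦embed⟧ X G (∀< t θ) ρ = ∀<-⇔ refl (λ y _ → ⟦embed⟧ X G θ (y ∷ᵉ ρ))
⟦embed⟧ X G (∃< t θ) ρ = ∃<-⇔ refl (λ y _ → ⟦embed⟧ X G θ (y ∷ᵉ ρ))

embed-prenex : ∀ X G n b θ ρ → QSat n b (embed θ) (X ⊕ G) ρ ⇔ QSat n b θ X ρ
embed-prenex X G n b θ ρ = QSat-cong n b (embed θ) θ (X ⊕ G) X ρ ρ (λ ys _ → ⟦embed⟧ X G θ (ys ++ᵉ ρ))

Σ⁰-embed : ∀ X G n A → Σ⁰ n X A → Σ⁰ n (X ⊕ G) A
Σ⁰-embed X G n A (θ , h) = embed θ , λ x → ⇔.trans (h x) (⇔.sym (embed-prenex X G n true θ (initEnv x)))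

Π⁰-embed : ∀ X G n A → Π⁰ n X A → Π⁰ n (X ⊕ G) A
Π⁰-embed X G n A (θ , h) = embed θ , λ x → ⇔.trans (h x) (⇔.sym (embed-prenex X G n false θ (initEnv x)))

module Complements (em : ExcludedMiddle 0ℓ) where
  open Classical em

  Π⁰⇒Σ⁰∁ : ∀ n Y A → Π⁰ n Y A → Σ⁰ n Y (∁ A)
  Π⁰⇒Σ⁰∁ n Y A (θ , h) = ¬ᶠ θ , λ x → ⇔.trans (∈∁ A x) (⇔.trans (¬-cong-⇔ (h x)) (QSat-¬ n false θ Y (initEnv x)))

  Σ⁰∁⇒Π⁰ : ∀ n Y A → Σ⁰ n Y (∁ A) → Π⁰ n Y A
  Σ⁰∁⇒Π⁰ n Y A (θ , h) = ¬ᶠ θ , λ x → ⇔.trans (∉∁ A x) (⇔.trans (¬-cong-⇔ (h x)) (QSat-¬ n true θ Y (initEnv x)))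

module Forcing (em : ExcludedMiddle 0ℓ) (X : Cantor) where
  open Classical em
  open Complements em

  -- `Forces k θ c ρ`: the condition c forces, over X ⊕ G, the prenex formula
  -- with k alternating quantifiers starting with ∀ and matrix θ.
  Forces : ℕ → Δ₀ → Cond → Env → Set
  Forces zero θ c ρ = ∀ H → c ≺ H → ⟦ θ ⟧ (X ⊕ H) ρ
  Forces (suc k) θ c ρ = ∀ y c' → c ⊑ c' → ¬ Forces k (¬ᶠ θ) c' (y ∷ᵉ ρ)

  Forces-mono : ∀ k θ ρ {c c'} → c ⊑ c' → Forces k θ c ρ → Forces k θ c' ρ
  Forces-mono zero θ ρ c⊑c' p H c'≺H = p H (⊑-≺ c⊑c' c'≺H)
  Forces-mono (suc k) θ ρ c⊑c' p y c'' c'⊑c'' = p y c'' (⊑-trans c⊑c' c'⊑c'')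

  -- The same notion with extensions restricted to coded conditions and the
  -- matrix evaluated at the condition's own bits: this version is
  -- arithmetical in X (see `definability`).
  ForcesCoded : ℕ → Δ₀ → Cond → Env → Set
  ForcesCoded zero θ c ρ = ⟦ θ ⟧ (X ⊕ bits c) ρ
  ForcesCoded (suc k) θ c ρ =
    ∀ y s d l → c ⊑ codedCond l d s → ¬ ForcesCoded k (¬ᶠ θ) (codedCond l d s) (y ∷ᵉ ρ)

  -- The two notions agree up to extension of the condition.  For matrices
  -- this is continuity; for quantifiers, every condition has a coded extension.
  mutual
    forces⇒coded : ∀ k θ ρ c → Forces k θ c ρ → ForcesCoded k θ c ρ
    forces⇒coded zero θ ρ c p = p (bits c) (≺-self c)
    forces⇒coded (suc k) θ ρ c p y s d l c⊑coded p'
      with coded⇒forces k (¬ᶠ θ) (y ∷ᵉ ρ) (codedCond l d s) p'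
    ... | c'' , coded⊑c'' , p'' = p y c'' (⊑-trans c⊑coded coded⊑c'') p''

    coded⇒forces : ∀ k θ ρ c → ForcesCoded k θ c ρ → Σ Cond λ c' → c ⊑ c' × Forces k θ c' ρ
    coded⇒forces zero θ ρ c p' with continuity (X ⊕ bits c) θ ρ
    ... | N , modulus = cond (N ⊔ len c) (bits c) , (m≤n⊔m N _ , λ i _ → refl) ,
          λ H a → to (modulus (X ⊕ H) (⊕-agree X (AgreeBelow-mono (m≤m⊔n N _) a))) p'
    coded⇒forces (suc k) θ ρ c p' = c , ⊑-refl c , λ y c' c⊑c' p → refute y c' c⊑c' p (coded-extension c')
      where
      refute : ∀ y c' → c ⊑ c' → Forces k (¬ᶠ θ) c' (y ∷ᵉ ρ) →
               (Σ ℕ λ d → Σ ℕ λ s → c' ⊑ codedCond (len c') d s) → ⊥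
      refute y c' c⊑c' p (d , s , c'⊑coded) = p' y s d (len c') (⊑-trans c⊑c' c'⊑coded)
        (forces⇒coded k (¬ᶠ θ) (y ∷ᵉ ρ) _ (Forces-mono k (¬ᶠ θ) (y ∷ᵉ ρ) c'⊑coded p))

  ExtendsF : Δ₀
  ExtendsF = ExtF (var 4) (var 5) (var 6) (var 0) (var 1) (var 2)

  -- `ForcingF k g θ`, read in context (l , d , s , ρ), is a Π-form matrix with
  -- k quantifiers over X expressing that codedCond l d s forces θ, whose
  -- variables are renamed into ρ by g.
  ForcingF : ℕ → (ℕ → ℕ) → Δ₀ → Δ₀
  ForcingF zero g θ = translate (λ i → 3 + g i) 1 2 θ
  ForcingF (suc k) g θ = merge³ false k (weaken k ExtendsF ⇒ᶠ ¬ᶠ ForcingF k (liftRen (λ i → 3 + g i)) (¬ᶠ θ))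

  definability : ∀ k g θ l d s ρ ρ' → Renames g ρ ρ' →
    QSat k false (ForcingF k g θ) X (l ∷ᵉ (d ∷ᵉ (s ∷ᵉ ρ))) ⇔ ForcesCoded k θ (codedCond l d s) ρ'
  definability zero g θ l d s ρ ρ' r = ⟦translate⟧ X (λ i → 3 + g i) 1 2 θ r
  definability (suc k) g θ l d s ρ ρ' r =
    ⇔.trans (⇔.sym (merge-∀⁴ k true Φ X E)) (∀-⇔ λ y → ∀-⇔ λ s' → ∀-⇔ λ d' → ∀-⇔ λ l' → matrix y s' d' l')
    where
    E = l ∷ᵉ (d ∷ᵉ (s ∷ᵉ ρ))
    g' = liftRen (λ i → 3 + g i)
    F = ForcingF k g' (¬ᶠ θ)
    Φ = weaken k ExtendsF ⇒ᶠ ¬ᶠ F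
    matrix : ∀ y s' d' l' → QSat k true Φ X (l' ∷ᵉ (d' ∷ᵉ (s' ∷ᵉ (y ∷ᵉ E)))) ⇔
      (codedCond l d s ⊑ codedCond l' d' s' → ¬ ForcesCoded k (¬ᶠ θ) (codedCond l' d' s') (y ∷ᵉ ρ'))
    matrix y s' d' l' = begin
      QSat k true Φ X E'
        ≈⟨ ⇔.sym (QSat-guard⇒ k true ExtendsF (¬ᶠ F) X E') ⟩
      (⟦ ExtendsF ⟧ X E' → QSat k true (¬ᶠ F) X E')
        ≈⟨ →-cong-⇔ (⟦ExtF⟧ X E' (var 4) (var 5) (var 6) (var 0) (var 1) (var 2)) (⇔.sym (QSat-¬ k false F X E')) ⟩
      (codedCond l d s ⊑ codedCond l' d' s' → ¬ QSat k false F X E')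
        ≈⟨ →-cong-⇔ ⇔.refl (¬-cong-⇔ (definability k g' (¬ᶠ θ) l' d' s' (y ∷ᵉ E) (y ∷ᵉ ρ') (Renames-lift y r))) ⟩
      (codedCond l d s ⊑ codedCond l' d' s' → ¬ ForcesCoded k (¬ᶠ θ) (codedCond l' d' s') (y ∷ᵉ ρ')) ∎
      where
      open import Relation.Binary.Reasoning.Setoid (⇔-setoid 0ℓ)
      E' = l' ∷ᵉ (d' ∷ᵉ (s' ∷ᵉ (y ∷ᵉ E)))

  -- x is in the set defined by "some coded extension of c₀ forces ψ at (x , y)
  -- for some y"; this is the Σ-form definition over X used for reflection.
  ForcedAbove : ℕ → Δ₀ → Cond → ℕ → Set
  ForcedAbove m ψ c₀ x = Σ ℕ λ y → Σ ℕ λ s → Σ ℕ λ d → Σ ℕ λ l →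
    (c₀ ⊑ codedCond l d s) × ForcesCoded m ψ (codedCond l d s) (y ∷ᵉ initEnv x)

  ForcedAboveF : ℕ → Δ₀ → ℕ → ℕ → ℕ → Δ₀
  ForcedAboveF m ψ l₀ d₀ s₀ =
    merge³ true m (weaken m (ExtF (numeral l₀) (numeral d₀) (numeral s₀) (var 0) (var 1) (var 2)) ∧ᶠ ForcingF m id ψ)

  ⟦ForcedAboveF⟧ : ∀ m ψ l₀ d₀ s₀ x →
    QSat (suc m) true (ForcedAboveF m ψ l₀ d₀ s₀) X (initEnv x) ⇔ ForcedAbove m ψ (codedCond l₀ d₀ s₀) x
  ⟦ForcedAboveF⟧ m ψ l₀ d₀ s₀ x =
    ⇔.trans (⇔.sym (merge-∃⁴ m false _ X (initEnv x))) (∃-⇔ λ y → ∃-⇔ λ s → ∃-⇔ λ d → ∃-⇔ λ l → matrix y s d l)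
    where
    numerals : ∀ ρ c → (codedCond (evalᵗ ρ (numeral l₀)) (evalᵗ ρ (numeral d₀)) (evalᵗ ρ (numeral s₀)) ⊑ c)
                       ⇔ (codedCond l₀ d₀ s₀ ⊑ c)
    numerals ρ c rewrite evalᵗ-numeral ρ l₀ | evalᵗ-numeral ρ d₀ | evalᵗ-numeral ρ s₀ = ⇔.refl
    matrix : ∀ y s d l → QSat m false (weaken m (ExtF (numeral l₀) (numeral d₀) (numeral s₀) (var 0) (var 1) (var 2))
                                       ∧ᶠ ForcingF m id ψ) X (l ∷ᵉ (d ∷ᵉ (s ∷ᵉ (y ∷ᵉ initEnv x))))
             ⇔ ((codedCond l₀ d₀ s₀ ⊑ codedCond l d s) × ForcesCoded m ψ (codedCond l d s) (y ∷ᵉ initEnv x))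
    matrix y s d l = ⇔.trans (⇔.sym (QSat-guard∧ m false _ (ForcingF m id ψ) X E))
      (⇔.trans (⟦ExtF⟧ X E (numeral l₀) (numeral d₀) (numeral s₀) (var 0) (var 1) (var 2)) (numerals E _)
       ×-⇔ definability m id ψ l d s (y ∷ᵉ initEnv x) (y ∷ᵉ initEnv x) (λ i → refl))
      where
      E = l ∷ᵉ (d ∷ᵉ (s ∷ᵉ (y ∷ᵉ initEnv x)))

  Meets : (Cond → Set) → Cantor → Set
  Meets D G = Σ Cond λ c → D c × c ≺ G

  Dense : (Cond → Set) → Set
  Dense D = ∀ c → Σ Cond λ c' → c ⊑ c' × D c'

  listEnv : List ℕ → Env
  listEnv zs = zs ++ᵉ (λ _ → zero)

  -- Conditions deciding ∀y ∃… θ: they force it, or force the dual formula at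
  -- some y.  Meeting all these families yields the truth lemma.
  Decides : ℕ → Δ₀ → List ℕ → Cond → Set
  Decides k θ zs c = Forces (suc k) θ c (listEnv zs) ⊎ Σ ℕ λ y → Forces k (¬ᶠ θ) c (y ∷ᵉ listEnv zs)

  Decides-dense : ∀ k θ zs → Dense (Decides k θ zs)
  Decides-dense k θ zs c with em {Forces (suc k) θ c (listEnv zs)}
  ... | yes p = c , ⊑-refl c , inj₁ p
  ... | no ¬p with em {Σ ℕ λ y → Σ Cond λ c' → c ⊑ c' × Forces k (¬ᶠ θ) c' (y ∷ᵉ listEnv zs)}
  ...   | yes (y , c' , c⊑c' , p) = c' , c⊑c' , inj₂ (y , p)
  ...   | no none = ⊥-elim (¬p (λ y c' c⊑c' p → none (y , c' , c⊑c' , p)))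

  DecidesAll : Cantor → Set
  DecidesAll G = ∀ k θ zs → Meets (Decides k θ zs) G

  module Truth (G : Cantor) (decides : DecidesAll G) where
    mutual
      forced⇒true : ∀ k θ zs c → c ≺ G → Forces k θ c (listEnv zs) → QSat k false θ (X ⊕ G) (listEnv zs)
      forced⇒true zero θ zs c c≺G p = p G c≺G
      forced⇒true (suc k) θ zs c c≺G p y with em {QSat k true θ (X ⊕ G) (y ∷ᵉ listEnv zs)}
      ... | yes q = q
      ... | no ¬q with true⇒forced k (¬ᶠ θ) (y ∷ zs) (to (QSat-¬ k true θ (X ⊕ G) (y ∷ᵉ listEnv zs)) ¬q)
      ...   | c' , c'≺G , p' = ⊥-elim (p y (join c c' G) (join-ext₁ c c' G c≺G)
                                 (Forces-mono k (¬ᶠ θ) (y ∷ᵉ listEnv zs) (join-ext₂ c c' G c'≺G) p'))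

      true⇒forced : ∀ k θ zs → QSat k false θ (X ⊕ G) (listEnv zs) → Σ Cond λ c → c ≺ G × Forces k θ c (listEnv zs)
      true⇒forced zero θ zs q with continuity (X ⊕ G) θ (listEnv zs)
      ... | N , modulus = cond N G , (λ _ _ → refl) , λ H a → to (modulus (X ⊕ H) (⊕-agree X a)) q
      true⇒forced (suc k) θ zs q with decides k θ zs
      ... | c , inj₁ p , c≺G = c , c≺G , p
      ... | c , inj₂ (y , p) , c≺G = ⊥-elim (from (QSat-¬ k true θ (X ⊕ G) (y ∷ᵉ listEnv zs))
                                       (forced⇒true k (¬ᶠ θ) (y ∷ zs) c c≺G p) (q y))

  Arith : ℕ → Bool → Δ₀ → ℕ → Set
  Arith m' b' φ x = QSat m' b' φ X (initEnv x)

  Arithmetical : Cantor → Set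
  Arithmetical A = Σ ℕ λ m' → Σ Bool λ b' → Σ Δ₀ λ φ → ∀ x → x ∈ˢ A ⇔ Arith m' b' φ x

  Arithmetical-∁ : ∀ A → Arithmetical A → Arithmetical (∁ A)
  Arithmetical-∁ A (m' , b' , φ , h) = m' , not b' , ¬ᶠ φ , λ x →
    ⇔.trans (∈∁ A x) (⇔.trans (¬-cong-⇔ (h x)) (QSat-¬ m' b' φ X (initEnv x)))

  -- Conditions separating the candidate Σ-definition ∃y ψ from the complement
  -- of an arithmetical set Ap: they force ψ at some point outside Ap, or no
  -- extension does.
  Separates : ℕ → Δ₀ → (ℕ → Set) → Cond → Set
  Separates m ψ Ap c = (Σ ℕ λ x → ¬ Ap x × Σ ℕ λ y → Forces m ψ c (y ∷ᵉ initEnv x))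
                     ⊎ (∀ c' → c ⊑ c' → ∀ x → ¬ Ap x → ∀ y → ¬ Forces m ψ c' (y ∷ᵉ initEnv x))

  Separates-dense : ∀ m ψ Ap → Dense (Separates m ψ Ap)
  Separates-dense m ψ Ap c
    with em {Σ Cond λ c' → c ⊑ c' × (Σ ℕ λ x → ¬ Ap x × Σ ℕ λ y → Forces m ψ c' (y ∷ᵉ initEnv x))}
  ... | yes (c' , c⊑c' , outside) = c' , c⊑c' , inj₁ outside
  ... | no none = c , ⊑-refl c , inj₂ (λ c' c⊑c' x ¬Ap y p → none (c' , c⊑c' , x , ¬Ap , y , p))

  Generic : Cantor → Set
  Generic G = DecidesAll G × (∀ m ψ m' b' φ → Meets (Separates m ψ (Arith m' b' φ)) G)

  -- If an initial segment c₁ of G forces ψ nowhere outside A, and A is Σ⁰ₘ₊₁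
  -- over X ⊕ G via ψ, then A is defined over X by "ψ is forced at x by a
  -- coded extension of (a code for) c₁".
  reflect-above : ∀ G → DecidesAll G → ∀ m ψ A →
    (∀ x → x ∈ˢ A ⇔ QSat (suc m) true ψ (X ⊕ G) (initEnv x)) →
    ∀ c₁ → c₁ ≺ G → (∀ c' → c₁ ⊑ c' → ∀ x → ¬ x ∈ˢ A → ∀ y → ¬ Forces m ψ c' (y ∷ᵉ initEnv x)) →
    Σ⁰ (suc m) X A
  reflect-above G decides m ψ A defA c₁ c₁≺G outside-unforced with coded-extension (cond (len c₁) G)
  ... | d₀ , s₀ , (_ , G≈c₀) = ForcedAboveF m ψ (len c₁) d₀ s₀ ,
                               λ x → ⇔.trans (mk⇔ (forth x) (back x)) (⇔.sym (⟦ForcedAboveF⟧ m ψ (len c₁) d₀ s₀ x))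
    where
    open Truth G decides
    c₀ = codedCond (len c₁) d₀ s₀
    c₁⊑c₀ : c₁ ⊑ c₀
    c₁⊑c₀ = ≤-refl , λ i i<l → trans (c₁≺G i i<l) (G≈c₀ i i<l)
    c₀≺G : c₀ ≺ G
    c₀≺G i i<l = sym (G≈c₀ i i<l)
    forth : ∀ x → x ∈ˢ A → ForcedAbove m ψ c₀ x
    forth x x∈A with to (defA x) x∈A
    ... | y , q with true⇒forced m ψ (y ∷ x ∷ []) q
    ...   | c , c≺G , p with coded-extension (join c c₀ G)
    ...     | d , s , join⊑coded = y , s , d , len (join c c₀ G) , ⊑-trans (join-ext₂ c c₀ G c₀≺G) join⊑coded ,
                forces⇒coded m ψ _ _ (Forces-mono m ψ _ (⊑-trans (join-ext₁ c c₀ G c≺G) join⊑coded) p)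
    back : ∀ x → ForcedAbove m ψ c₀ x → x ∈ˢ A
    back x (y , s , d , l , c₀⊑coded , p') with coded⇒forces m ψ (y ∷ᵉ initEnv x) (codedCond l d s) p'
    ... | c' , coded⊑c' , p with em {x ∈ˢ A}
    ...   | yes x∈A = x∈A
    ...   | no x∉A = ⊥-elim (outside-unforced c' (⊑-trans c₁⊑c₀ (⊑-trans c₀⊑coded coded⊑c')) x x∉A y p)

  Σ-reflection : ∀ G → Generic G → ∀ m A → Arithmetical A → Σ⁰ (suc m) (X ⊕ G) A → Σ⁰ (suc m) X A
  Σ-reflection G (decides , separates) m A (m' , b' , φ , arith) (ψ , defA) with separates m ψ m' b' φ
  ... | c₁ , inj₁ (x , x∉A , y , p) , c₁≺G =
    ⊥-elim (x∉A (to (arith x) (from (defA x) (y , Truth.forced⇒true G decides m ψ (y ∷ x ∷ []) c₁ c₁≺G p))))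
  ... | c₁ , inj₂ unforced , c₁≺G = reflect-above G decides m ψ A defA c₁ c₁≺G
          λ c' c₁⊑c' x x∉A → unforced c' c₁⊑c' x (λ ap → x∉A (from (arith x) ap))

  Π-reflection : ∀ G → Generic G → ∀ m A → Arithmetical A → Π⁰ (suc m) (X ⊕ G) A → Π⁰ (suc m) X A
  Π-reflection G gen m A arith π = Σ⁰∁⇒Π⁰ (suc m) X A
    (Σ-reflection G gen m (∁ A) (Arithmetical-∁ A arith) (Π⁰⇒Σ⁰∁ (suc m) (X ⊕ G) A π))

  -- Every class relative to X is contained in the class relative to X ⊕ G,
  -- and reflection rules out that a set becomes simpler relative to X ⊕ G.
  preserves : ∀ G → Generic G → PreservesAH X G
  preserves G gen (suc m) _ A = properΣ , properΠ , properΔ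
    where
    properΣ : ProperΣ⁰ (suc m) X A → ProperΣ⁰ (suc m) (X ⊕ G) A
    properΣ (σ , ¬π) = Σ⁰-embed X G (suc m) A σ , λ π → ¬π (Π-reflection G gen m A (suc m , true , σ) π)
    properΠ : ProperΠ⁰ (suc m) X A → ProperΠ⁰ (suc m) (X ⊕ G) A
    properΠ (π , ¬σ) = Π⁰-embed X G (suc m) A π , λ σ → ¬σ (Σ-reflection G gen m A (suc m , false , π) σ)
    properΔ : ProperΔ⁰suc (suc m) X A → ProperΔ⁰suc (suc m) (X ⊕ G) A
    properΔ ((σ , π) , ¬σ , ¬π) = (Σ⁰-embed X G (suc (suc m)) A σ , Π⁰-embed X G (suc (suc m)) A π) ,
      (λ σ' → ¬σ (Σ-reflection G gen m A (suc (suc m) , true , σ) σ')) ,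
      (λ π' → ¬π (Π-reflection G gen m A (suc (suc m) , true , σ) π'))

  -- The generic sets form a comeager set: enumerate both families of dense
  -- sets and let the n-th open set require meeting the n-th member of each.
  DecidesIndex : Set
  DecidesIndex = ℕ × Δ₀ × List ℕ

  SeparatesIndex : Set
  SeparatesIndex = ℕ × Δ₀ × ℕ × Bool × Δ₀

  enum-decides : Enumeration DecidesIndex
  enum-decides = enum-× enum-ℕ (enum-× enum-Δ₀ enum-List)

  enum-separates : Enumeration SeparatesIndex
  enum-separates = enum-× enum-ℕ (enum-× enum-Δ₀ (enum-× enum-ℕ (enum-× enum-Bool enum-Δ₀)))

  DecidesAt : DecidesIndex → Cond → Set
  DecidesAt (k , θ , zs) = Decides k θ zs

  SeparatesAt : SeparatesIndex → Cond → Set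
  SeparatesAt (m , ψ , m' , b' , φ) = Separates m ψ (Arith m' b' φ)

  Stage : ℕ → Cantor → Set
  Stage n G = Meets (DecidesAt (proj₁ enum-decides n)) G × Meets (SeparatesAt (proj₁ enum-separates n)) G

  -- Meeting a family is witnessed by an initial segment, hence open.
  Meets-open : ∀ D G → Meets D G → Σ ℕ λ N → ∀ H → AgreeBelow N G H → Meets D H
  Meets-open D G (c , Dc , c≺G) = len c , λ H a → c , Dc , λ i i<l → trans (c≺G i i<l) (a i i<l)

  Stage-open : ∀ n → IsOpen (Stage n)
  Stage-open n G (meet₁ , meet₂) with Meets-open _ G meet₁ | Meets-open _ G meet₂
  ... | N₁ , open₁ | N₂ , open₂ = N₁ ⊔ N₂ , λ H a →
    open₁ H (AgreeBelow-mono (m≤m⊔n N₁ N₂) a) , open₂ H (AgreeBelow-mono (m≤n⊔m N₁ N₂) a)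

  DecidesAt-dense : ∀ i → Dense (DecidesAt i)
  DecidesAt-dense (k , θ , zs) = Decides-dense k θ zs

  SeparatesAt-dense : ∀ i → Dense (SeparatesAt i)
  SeparatesAt-dense (m , ψ , m' , b' , φ) = Separates-dense m ψ (Arith m' b' φ)

  Stage-dense : ∀ n → IsDense (Stage n)
  Stage-dense n G k with DecidesAt-dense (proj₁ enum-decides n) (cond k G)
  ... | c₁ , G⊑c₁ , D₁ with SeparatesAt-dense (proj₁ enum-separates n) c₁
  ...   | c₂ , c₁⊑c₂ , D₂ = bits c₂ , proj₂ (⊑-trans G⊑c₁ c₁⊑c₂) ,
                            (c₁ , D₁ , ⊑-≺ c₁⊑c₂ (≺-self c₂)) , (c₂ , D₂ , ≺-self c₂)

  Stages⇒Generic : ∀ G → (∀ n → Stage n G) → Generic G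
  Stages⇒Generic G stages = (λ k θ zs → decides (proj₂ enum-decides (k , θ , zs)))
                          , (λ m ψ m' b' φ → separates (proj₂ enum-separates (m , ψ , m' , b' , φ)))
    where
    decides : ∀ {i} → (Σ ℕ λ n → proj₁ enum-decides n ≡ i) → Meets (DecidesAt i) G
    decides (n , refl) = proj₁ (stages n)
    separates : ∀ {i} → (Σ ℕ λ n → proj₁ enum-separates n ≡ i) → Meets (SeparatesAt i) G
    separates (n , refl) = proj₂ (stages n)

proposition3p1 : ExcludedMiddle 0ℓ → (X : Cantor) →
    Σ (Cantor → Set) λ C → IsComeager C × ((G : Cantor) → C G → PreservesAH X G)
proposition3p1 em X = Generic , (Stage , (λ n → Stage-open n , Stage-dense n) , Stages⇒Generic) , preserves
  where open Forcing em X
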